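{- Let $D=\{e_1,\dots,e_d\}$, let $P$ be the cyclic shift $Pe_i=e_{i+1}$ (indices modulo $d$), and let $1\le s<d$. Consider the equivalence classes of $s$-element subsets of $D$ under the action of $P$. Then there is a one-to-one map $\Theta$ from the set of special classes into the set of sets of regular classes such that: (i) if $S$ is special with block size $b$ and $n=d/b$, then $\Theta[S]$ consists of exactly $n-1$ regular classes; (ii) $\Theta[S_1]\cap\Theta[S_2]=\emptyset$ whenever $[S_1]\ne[S_2]$.
   Context: A subset $S\subseteq D$ is regular if its orbit under $P$ has exactly $d$ members, and special otherwise; the class $[S]$ is regular or special accordingly. The block size of $S$ is the smallest positive integer $b$ with $P^bS=S$; it divides $d$. -}

module Defs where

open import Data.Nat using (ℕ; zero; suc; _<_)
open import Data.Fin using (Fin; toℕ)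
open import Data.Fin.Subset using (Subset)
open import Data.Vec using ([]; _∷_; init; last)
open import Data.List using (List)
open import Data.List.Membership.Propositional using (_∈_)
open import Data.Product using (Σ; ∃; _×_)
open import Relation.Binary.PropositionalEquality using (_≡_; _≢_)
open import Relation.Nullary using (¬_)

-- D = {e_0, ..., e_{d-1}} is Fin d; a subset S ⊆ D is a Subset d (characteristic vector).
-- P is the cyclic shift e_i ↦ e_{i+1} (mod d), acting on subsets:
-- i ∈ P S  iff  i-1 ∈ S, i.e. the characteristic vector is rotated right by one.
P : ∀ {d} → Subset d → Subset d
P [] = []
P (x ∷ xs) = last (x ∷ xs) ∷ init (x ∷ xs)

P^ : ∀ {d} → ℕ → Subset d → Subset d
P^ zero S = S
P^ (suc k) S = P (P^ k S)

_~_ : ∀ {d} → Subset d → Subset d → Set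
S ~ T = ∃ λ k → P^ k S ≡ T

-- The orbit of S is {P^k S : 0 ≤ k < d} (as P^d = id); it has exactly d members
-- iff these d subsets are pairwise distinct.
Regular : ∀ {d} → Subset d → Set
Regular {d} S = ∀ (i j : Fin d) → P^ (toℕ i) S ≡ P^ (toℕ j) S → i ≡ j

Special : ∀ {d} → Subset d → Set
Special S = ¬ Regular S

IsBlockSize : ∀ {d} → Subset d → ℕ → Set
IsBlockSize S b = (0 < b) × (P^ b S ≡ S) × (∀ c → 0 < c → c < b → P^ c S ≢ S)

-- two lists of representatives describe the same set of classes
SameClasses : ∀ {d} → List (Subset d) → List (Subset d) → Set
SameClasses L₁ L₂ =
  (∀ {T} → T ∈ L₁ → Σ _ λ T′ → T′ ∈ L₂ × T ~ T′) ×
  (∀ {T} → T ∈ L₂ → Σ _ λ T′ → T′ ∈ L₁ × T ~ T′)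

module Submission where

open import Defs
open import Data.Bool using (Bool; true; false; not; if_then_else_)
open import Data.Bool.Properties using (¬-not; not-injective)
open import Data.Nat
open import Data.Nat.Properties
open import Data.Nat.DivMod
open import Data.Vec using (Vec; []; _∷_; _∷ʳ_; initLast)
open import Data.Vec.Properties using (init-∷ʳ; last-∷ʳ; ≡-dec)
open import Data.Fin using (toℕ)
open import Data.Fin.Properties using (toℕ-injective; toℕ<n)
open import Data.Fin.Subset using (Subset; ∣_∣)
open import Data.List using (List; length; applyUpTo)
open import Data.List.Properties using (length-applyUpTo)
open import Data.List.Membership.Propositional using (_∈_)
open import Data.List.Membership.Propositional.Properties using (∈-applyUpTo⁺; ∈-applyUpTo⁻)
open import Data.List.Relation.Unary.All using (All)
open import Data.List.Relation.Unary.AllPairs using (AllPairs)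
import Data.List.Relation.Unary.All.Properties as All
import Data.List.Relation.Unary.AllPairs.Properties as AllPairs
open import Data.Product using (Σ; _×_; _,_; proj₁; proj₂)
open import Data.Sum using (_⊎_; inj₁; inj₂)
open import Data.Empty using (⊥; ⊥-elim)
open import Relation.Binary.Definitions using (tri<; tri≈; tri>)
open import Relation.Binary.PropositionalEquality
open import Relation.Nullary using (¬_; Dec; yes; no; does)
open import Relation.Nullary.Decidable using (dec-true; dec-false)

-- Read subsets of D as cyclic binary words of length d, ordered lexicographically with 0 < 1, and
-- represent a class by its least member C. A word strictly smaller than all its proper rotations
-- (a Lyndon word) is regular, and two such words in one class are equal. A special C is u^n for a
-- block u of length b = d/n with z zeros and t ones, n ≥ 2, and for 0 < k < n we turn C into a Lyndon
-- word of weight s: if C has a one before position z, replace its first k blocks by 0^z 1^t;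
-- otherwise u = 0^z 1^t and we move the first zero of block k + 1 to the front (taking 0^(d−s) 1^s
-- when z = k = 1). The leading run of zeros and ones of such a word determines z and t, hence b,
-- and one more position then determines k and C. So the n − 1 words give distinct regular classes,
-- and distinct special classes give disjoint sets of them.

-- Positions beyond the length read as false.
_!_ : ∀ {n} → Vec Bool n → ℕ → Bool
[] ! i = false
(x ∷ xs) ! zero = x
(x ∷ xs) ! suc i = xs ! i

build : (ℕ → Bool) → (n : ℕ) → Vec Bool n
build g zero = []
build g (suc n) = g 0 ∷ build (λ i → g (suc i)) n

build-! : ∀ g n i → i < n → build g n ! i ≡ g i
build-! g (suc n) zero _ = refl
build-! g (suc n) (suc i) (s≤s i<n) = build-! (λ j → g (suc j)) n i i<n

!-ext : ∀ {n} (u v : Vec Bool n) → (∀ i → i < n → u ! i ≡ v ! i) → u ≡ v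
!-ext [] [] _ = refl
!-ext (x ∷ u) (y ∷ v) h = cong₂ _∷_ (h 0 z<s) (!-ext u v (λ i i<n → h (suc i) (s≤s i<n)))

∷ʳ-!-< : ∀ {n} (xs : Vec Bool n) x i → i < n → (xs ∷ʳ x) ! i ≡ xs ! i
∷ʳ-!-< (y ∷ xs) x zero _ = refl
∷ʳ-!-< (y ∷ xs) x (suc i) (s≤s i<n) = ∷ʳ-!-< xs x i i<n

∷ʳ-!-last : ∀ {n} (xs : Vec Bool n) x → (xs ∷ʳ x) ! n ≡ x
∷ʳ-!-last [] x = refl
∷ʳ-!-last (y ∷ xs) x = ∷ʳ-!-last xs x

P-∷ʳ : ∀ {n} (xs : Vec Bool n) x → P (xs ∷ʳ x) ≡ x ∷ xs
P-∷ʳ [] x = refl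
P-∷ʳ (y ∷ xs) x = cong₂ _∷_ (last-∷ʳ x (y ∷ xs)) (init-∷ʳ x (y ∷ xs))

P-!-suc : ∀ {n} (v : Vec Bool (suc n)) i → i < n → P v ! suc i ≡ v ! i
P-!-suc v i i<n with initLast v
... | xs , x , refl rewrite P-∷ʳ xs x = sym (∷ʳ-!-< xs x i i<n)

P-!-zero : ∀ {n} (v : Vec Bool (suc n)) → P v ! 0 ≡ v ! n
P-!-zero v with initLast v
... | xs , x , refl rewrite P-∷ʳ xs x = sym (∷ʳ-!-last xs x)

P^-+ : ∀ {n} a b (S : Subset n) → P^ (a + b) S ≡ P^ a (P^ b S)
P^-+ zero b S = refl
P^-+ (suc a) b S = cong P (P^-+ a b S)

P^-comm : ∀ {n} a b (S : Subset n) → P^ a (P^ b S) ≡ P^ b (P^ a S)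
P^-comm a b S = trans (sym (P^-+ a b S)) (trans (cong (λ c → P^ c S) (+-comm a b)) (P^-+ b a S))

bool→ℕ : Bool → ℕ
bool→ℕ true = 1
bool→ℕ false = 0

bool→ℕ≤1 : ∀ x → bool→ℕ x ≤ 1
bool→ℕ≤1 true = s≤s z≤n
bool→ℕ≤1 false = z≤n

count : (ℕ → Bool) → ℕ → ℕ
count g zero = 0
count g (suc m) = bool→ℕ (g 0) + count (λ i → g (suc i)) m

count-ext : ∀ g h m → (∀ i → i < m → g i ≡ h i) → count g m ≡ count h m
count-ext g h zero _ = refl
count-ext g h (suc m) e = cong₂ _+_ (cong bool→ℕ (e 0 z<s)) (count-ext _ _ m (λ i i<m → e (suc i) (s≤s i<m)))

count-+ : ∀ g a b → count g (a + b) ≡ count g a + count (λ i → g (a + i)) b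
count-+ g zero b = refl
count-+ g (suc a) b = trans (cong (bool→ℕ (g 0) +_) (count-+ (λ i → g (suc i)) a b)) (sym (+-assoc (bool→ℕ (g 0)) _ _))

count≤ : ∀ g m → count g m ≤ m
count≤ g zero = z≤n
count≤ g (suc m) = +-mono-≤ (bool→ℕ≤1 (g 0)) (count≤ _ m)

count≡m⇒all : ∀ g m → count g m ≡ m → ∀ i → i < m → g i ≡ true
count≡m⇒all g (suc m) e i i<m with g 0 in g0
count≡m⇒all g (suc m) e zero _ | true = g0
count≡m⇒all g (suc m) e (suc i) (s≤s i<m) | true = count≡m⇒all _ m (suc-injective e) i i<m
... | false = ⊥-elim (1+n≰n (subst (_≤ m) e (count≤ _ m)))

count-all-true : ∀ g m → (∀ i → i < m → g i ≡ true) → count g m ≡ m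
count-all-true g zero _ = refl
count-all-true g (suc m) h rewrite h 0 z<s = cong suc (count-all-true _ m (λ i i<m → h (suc i) (s≤s i<m)))

count-all-false : ∀ g m → (∀ i → i < m → g i ≡ false) → count g m ≡ 0
count-all-false g zero _ = refl
count-all-false g (suc m) h rewrite h 0 z<s = count-all-false _ m (λ i i<m → h (suc i) (s≤s i<m))

count-periodic : ∀ g b → (∀ i → g (i + b) ≡ g i) → ∀ k → count g (k * b) ≡ k * count g b
count-periodic g b per zero = refl
count-periodic g b per (suc k) = trans (count-+ g b (k * b))
  (cong (count g b +_) (trans (count-ext _ _ (k * b) (λ i _ → trans (cong g (+-comm b i)) (per i)))
                              (count-periodic g b per k)))

∣∷∣ : ∀ {n} x (xs : Vec Bool n) → ∣ x ∷ xs ∣ ≡ bool→ℕ x + ∣ xs ∣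
∣∷∣ true xs = refl
∣∷∣ false xs = refl

∣∣≡count : ∀ {n} (v : Vec Bool n) → ∣ v ∣ ≡ count (v !_) n
∣∣≡count [] = refl
∣∣≡count (x ∷ v) = trans (∣∷∣ x v) (cong (bool→ℕ x +_) (∣∣≡count v))

∣build∣ : ∀ g n → ∣ build g n ∣ ≡ count g n
∣build∣ g n = trans (∣∣≡count (build g n)) (count-ext _ _ n (build-! g n))

∣∷ʳ∣ : ∀ {n} (xs : Vec Bool n) x → ∣ xs ∷ʳ x ∣ ≡ ∣ xs ∣ + bool→ℕ x
∣∷ʳ∣ [] true = refl
∣∷ʳ∣ [] false = refl
∣∷ʳ∣ (y ∷ xs) x = begin
  ∣ y ∷ (xs ∷ʳ x) ∣             ≡⟨ ∣∷∣ y (xs ∷ʳ x) ⟩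
  bool→ℕ y + ∣ xs ∷ʳ x ∣        ≡⟨ cong (bool→ℕ y +_) (∣∷ʳ∣ xs x) ⟩
  bool→ℕ y + (∣ xs ∣ + bool→ℕ x) ≡⟨ sym (+-assoc (bool→ℕ y) _ _) ⟩
  bool→ℕ y + ∣ xs ∣ + bool→ℕ x   ≡⟨ cong (_+ bool→ℕ x) (sym (∣∷∣ y xs)) ⟩
  ∣ y ∷ xs ∣ + bool→ℕ x          ∎
  where open ≡-Reasoning

∣P∣ : ∀ {n} (v : Vec Bool n) → ∣ P v ∣ ≡ ∣ v ∣
∣P∣ [] = refl
∣P∣ {suc n} v with initLast v
... | xs , x , refl rewrite P-∷ʳ xs x = trans (∣∷∣ x xs) (trans (+-comm (bool→ℕ x) _) (sym (∣∷ʳ∣ xs x)))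

∣P^∣ : ∀ {n} k (v : Vec Bool n) → ∣ P^ k v ∣ ≡ ∣ v ∣
∣P^∣ zero v = refl
∣P^∣ (suc k) v = trans (∣P∣ (P^ k v)) (∣P^∣ k v)

Least : (ℕ → Set) → ℕ → Set
Least Q m = (Σ ℕ λ i → i < m × Q i × (∀ j → j < i → ¬ Q j)) ⊎ (∀ i → i < m → ¬ Q i)

least : (Q : ℕ → Set) → (∀ n → Dec (Q n)) → ∀ m → Least Q m
least Q Q? zero = inj₂ (λ i ())
least Q Q? (suc m) with least Q Q? m
... | inj₁ (i , i<m , q , h) = inj₁ (i , m<n⇒m<1+n i<m , q , h)
... | inj₂ h with Q? m
...   | yes q = inj₁ (m , ≤-refl , q , h)
...   | no ¬q = inj₂ below
  where
  below : ∀ i → i < suc m → ¬ Q i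
  below i i<1+m with m≤n⇒m<n∨m≡n (≤-pred i<1+m)
  ... | inj₁ i<m = h i i<m
  ... | inj₂ refl = ¬q

FirstTrue : (ℕ → Bool) → ℕ → Set
FirstTrue g m = (Σ ℕ λ i → i < m × g i ≡ true × (∀ j → j < i → g j ≡ false)) ⊎ (∀ i → i < m → g i ≡ false)

firstTrue : ∀ g m → FirstTrue g m
firstTrue g m with least (λ i → g i ≡ true) (λ i → g i Data.Bool.≟ true) m
... | inj₁ (i , i<m , gi , h) = inj₁ (i , i<m , gi , λ j j<i → ¬-not (h j j<i))
... | inj₂ h = inj₂ (λ i i<m → ¬-not (h i i<m))

true≢false : true ≢ false
true≢false ()

IsBlockSize-unique : ∀ {n} {S : Subset n} {b c} → IsBlockSize S b → IsBlockSize S c → b ≡ c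
IsBlockSize-unique {b = b} {c} (0<b , Sb , least-b) (0<c , Sc , least-c) with <-cmp b c
... | tri< b<c _ _ = ⊥-elim (least-c b 0<b b<c Sb)
... | tri≈ _ b≡c _ = b≡c
... | tri> _ _ c<b = ⊥-elim (least-b c 0<c c<b Sc)

if-yes : ∀ {A Q : Set} (q? : Dec Q) {x y : A} → Q → (if does q? then x else y) ≡ x
if-yes q? q rewrite dec-true q? q = refl

if-no : ∀ {A Q : Set} (q? : Dec Q) {x y : A} → ¬ Q → (if does q? then x else y) ≡ y
if-no q? ¬q rewrite dec-false q? ¬q = refl

-- Read on [0, b), step z is the block 0^z 1^(b − z).
step : ℕ → ℕ → Bool
step z i = does (z ≤? i)

step-≥ : ∀ z {i} → z ≤ i → step z i ≡ true
step-≥ z {i} = dec-true (z ≤? i)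

step-< : ∀ z {i} → i < z → step z i ≡ false
step-< z {i} i<z = dec-false (z ≤? i) (<⇒≱ i<z)

count-step : ∀ z t → count (step z) (z + t) ≡ t
count-step z t = begin
  count (step z) (z + t)                              ≡⟨ count-+ (step z) z t ⟩
  count (step z) z + count (λ i → step z (z + i)) t   ≡⟨ cong₂ _+_ (count-all-false (step z) z (λ i → step-< z))
                                                                   (count-all-true _ t (λ i _ → step-≥ z (m≤m+n z i))) ⟩
  t                                                   ∎
  where open ≡-Reasoning

lex≤ : ∀ {n} → Vec Bool n → Vec Bool n → Bool
lex≤ [] [] = true
lex≤ (false ∷ xs) (false ∷ ys) = lex≤ xs ys
lex≤ (true ∷ xs) (true ∷ ys) = lex≤ xs ys
lex≤ (false ∷ xs) (true ∷ ys) = true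
lex≤ (true ∷ xs) (false ∷ ys) = false

lex≤-refl : ∀ {n} (u : Vec Bool n) → lex≤ u u ≡ true
lex≤-refl [] = refl
lex≤-refl (false ∷ u) = lex≤-refl u
lex≤-refl (true ∷ u) = lex≤-refl u

lex≤-antisym : ∀ {n} (u v : Vec Bool n) → lex≤ u v ≡ true → lex≤ v u ≡ true → u ≡ v
lex≤-antisym [] [] _ _ = refl
lex≤-antisym (false ∷ u) (false ∷ v) p q = cong (false ∷_) (lex≤-antisym u v p q)
lex≤-antisym (true ∷ u) (true ∷ v) p q = cong (true ∷_) (lex≤-antisym u v p q)

lex≤-trans : ∀ {n} (u v w : Vec Bool n) → lex≤ u v ≡ true → lex≤ v w ≡ true → lex≤ u w ≡ true
lex≤-trans [] [] [] _ _ = refl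
lex≤-trans (false ∷ u) (false ∷ v) (false ∷ w) p q = lex≤-trans u v w p q
lex≤-trans (false ∷ u) (false ∷ v) (true ∷ w) _ _ = refl
lex≤-trans (false ∷ u) (true ∷ v) (true ∷ w) _ _ = refl
lex≤-trans (true ∷ u) (true ∷ v) (true ∷ w) p q = lex≤-trans u v w p q

lex≰⇒lex≥ : ∀ {n} (u v : Vec Bool n) → lex≤ u v ≡ false → lex≤ v u ≡ true
lex≰⇒lex≥ [] [] ()
lex≰⇒lex≥ (false ∷ u) (false ∷ v) p = lex≰⇒lex≥ u v p
lex≰⇒lex≥ (true ∷ u) (true ∷ v) p = lex≰⇒lex≥ u v p
lex≰⇒lex≥ (true ∷ u) (false ∷ v) _ = refl

LexLt : ∀ {n} → Vec Bool n → Vec Bool n → Set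
LexLt {n} u v = Σ ℕ λ j → j < n × (∀ i → i < j → u ! i ≡ v ! i) × u ! j ≡ false × v ! j ≡ true

LexLt⇒lex≰ : ∀ {n} (u v : Vec Bool n) → LexLt u v → lex≤ v u ≡ false
LexLt⇒lex≰ (false ∷ u) (true ∷ v) (zero , _) = refl
LexLt⇒lex≰ (x ∷ u) (y ∷ v) (suc j , s≤s j<n , h , uj , vj) with h 0 z<s
LexLt⇒lex≰ (false ∷ u) (false ∷ v) (suc j , s≤s j<n , h , uj , vj) | refl =
  LexLt⇒lex≰ u v (j , j<n , (λ i i<j → h (suc i) (s≤s i<j)) , uj , vj)
LexLt⇒lex≰ (true ∷ u) (true ∷ v) (suc j , s≤s j<n , h , uj , vj) | refl =
  LexLt⇒lex≰ u v (j , j<n , (λ i i<j → h (suc i) (s≤s i<j)) , uj , vj)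

lexMin : ∀ {n} → Vec Bool n → Vec Bool n → Vec Bool n
lexMin u v = if lex≤ u v then u else v

lexMin-≤ˡ : ∀ {n} (u v : Vec Bool n) → lex≤ (lexMin u v) u ≡ true
lexMin-≤ˡ u v with lex≤ u v in u≤v
... | true = lex≤-refl u
... | false = lex≰⇒lex≥ u v u≤v

lexMin-≤ʳ : ∀ {n} (u v : Vec Bool n) → lex≤ (lexMin u v) v ≡ true
lexMin-≤ʳ u v with lex≤ u v in u≤v
... | true = u≤v
... | false = lex≤-refl v

lexMin-sel : ∀ {n} (u v : Vec Bool n) → lexMin u v ≡ u ⊎ lexMin u v ≡ v
lexMin-sel u v with lex≤ u v
... | true = inj₁ refl
... | false = inj₂ refl

-- Subsets of Fin d read as d-periodic bit sequences; writing d = suc d' makes _% d available.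
module Cyclic (d' : ℕ) where
  d : ℕ
  d = suc d'

  bit : Vec Bool d → ℕ → Bool
  bit v i = v ! (i % d)

  bit-< : ∀ v i → i < d → bit v i ≡ v ! i
  bit-< v i i<d = cong (v !_) (m<n⇒m%n≡m i<d)

  bit-+d : ∀ v i → bit v (i + d) ≡ bit v i
  bit-+d v i = cong (v !_) ([m+n]%n≡m%n i d)

  bit-ext : ∀ u v → (∀ i → i < d → bit u i ≡ bit v i) → u ≡ v
  bit-ext u v h = !-ext u v (λ i i<d → trans (sym (bit-< u i i<d)) (trans (h i i<d) (bit-< v i i<d)))

  bit-+% : ∀ v i r → bit v (i + r % d) ≡ bit v (i + r)
  bit-+% v i r = cong (v !_) (begin
    (i + r % d) % d         ≡⟨ %-distribˡ-+ i (r % d) d ⟩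
    (i % d + r % d % d) % d ≡⟨ cong (λ x → (i % d + x) % d) (m%n%n≡m%n r d) ⟩
    (i % d + r % d) % d     ≡⟨ sym (%-distribˡ-+ i r d) ⟩
    (i + r) % d             ∎)
    where open ≡-Reasoning

  suc-%-unfold : ∀ i → suc i % d ≡ suc (i % d) % d
  suc-%-unfold i = begin
    suc i % d                       ≡⟨ cong (λ x → suc x % d) (m≡m%n+[m/n]*n i d) ⟩
    (suc (i % d) + (i / d) * d) % d ≡⟨ [m+kn]%n≡m%n (suc (i % d)) (i / d) d ⟩
    suc (i % d) % d                 ∎
    where open ≡-Reasoning

  suc-% : ∀ i → (suc (i % d) < d × suc i % d ≡ suc (i % d)) ⊎ (suc (i % d) ≡ d × suc i % d ≡ 0)
  suc-% i with suc (i % d) <? d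
  ... | yes p = inj₁ (p , trans (suc-%-unfold i) (m<n⇒m%n≡m p))
  ... | no ¬p = inj₂ (wrap , trans (suc-%-unfold i) (trans (cong (_% d) wrap) (n%n≡0 d)))
    where
    wrap : suc (i % d) ≡ d
    wrap = ≤-antisym (m%n<n i d) (≮⇒≥ ¬p)

  bit-P : ∀ v i → bit (P v) (suc i) ≡ bit v i
  bit-P v i with suc-% i
  ... | inj₁ (p , e) rewrite e = P-!-suc v (i % d) (≤-pred p)
  ... | inj₂ (wrap , e) rewrite e = trans (P-!-zero v) (cong (v !_) (sym (suc-injective wrap)))

  bit-P^ : ∀ k v i → bit (P^ k v) (i + k) ≡ bit v i
  bit-P^ zero v i = cong (bit v) (+-identityʳ i)
  bit-P^ (suc k) v i = trans (cong (bit (P (P^ k v))) (+-suc i k)) (trans (bit-P (P^ k v) (i + k)) (bit-P^ k v i))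

  bit-P^-∸ : ∀ r v i → r ≤ d → bit (P^ (d ∸ r) v) i ≡ bit v (i + r)
  bit-P^-∸ r v i r≤d = begin
    bit (P^ (d ∸ r) v) i                 ≡⟨ sym (bit-+d (P^ (d ∸ r) v) i) ⟩
    bit (P^ (d ∸ r) v) (i + d)           ≡⟨ cong (bit (P^ (d ∸ r) v)) i+d ⟩
    bit (P^ (d ∸ r) v) (i + r + (d ∸ r)) ≡⟨ bit-P^ (d ∸ r) v (i + r) ⟩
    bit v (i + r)                        ∎
    where
    open ≡-Reasoning
    i+d : i + d ≡ i + r + (d ∸ r)
    i+d = trans (cong (i +_) (sym (m+[n∸m]≡n r≤d))) (sym (+-assoc i r (d ∸ r)))

  bit-P^-≤ : ∀ k v i → k ≤ d → bit (P^ k v) i ≡ bit v (i + (d ∸ k))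
  bit-P^-≤ k v i k≤d = trans (cong (λ x → bit (P^ x v) i) (sym (m∸[m∸n]≡n k≤d))) (bit-P^-∸ (d ∸ k) v i (m∸n≤m d k))

  P^-d : ∀ (v : Vec Bool d) → P^ d v ≡ v
  P^-d v = bit-ext _ _ (λ i _ → trans (sym (bit-+d (P^ d v) i)) (bit-P^ d v i))

  P^-*d : ∀ k (v : Vec Bool d) → P^ (k * d) v ≡ v
  P^-*d zero v = refl
  P^-*d (suc k) v = trans (P^-+ d (k * d) v) (trans (cong (P^ d) (P^-*d k v)) (P^-d v))

  P^-% : ∀ k (v : Vec Bool d) → P^ k v ≡ P^ (k % d) v
  P^-% k v = trans (cong (λ x → P^ x v) (m≡m%n+[m/n]*n k d))
               (trans (P^-+ (k % d) ((k / d) * d) v) (cong (P^ (k % d)) (P^-*d (k / d) v)))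

  inv : ℕ → ℕ
  inv a = d ∸ a % d

  P^-inv : ∀ a (v : Vec Bool d) → P^ (inv a) (P^ a v) ≡ v
  P^-inv a v = begin
    P^ (inv a) (P^ a v)        ≡⟨ cong (P^ (inv a)) (P^-% a v) ⟩
    P^ (inv a) (P^ (a % d) v)  ≡⟨ sym (P^-+ (inv a) (a % d) v) ⟩
    P^ (inv a + a % d) v       ≡⟨ cong (λ x → P^ x v) (m∸n+n≡m (<⇒≤ (m%n<n a d))) ⟩
    P^ d v                     ≡⟨ P^-d v ⟩
    v                          ∎
    where open ≡-Reasoning

  bit-P^-inv : ∀ r v i → bit (P^ (inv r) v) i ≡ bit v (i + r)
  bit-P^-inv r v i = trans (bit-P^-∸ (r % d) v i (<⇒≤ (m%n<n r d))) (bit-+% v i r)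

  P^-injective : ∀ a (u v : Vec Bool d) → P^ a u ≡ P^ a v → u ≡ v
  P^-injective a u v e = trans (sym (P^-inv a u)) (trans (cong (P^ (inv a)) e) (P^-inv a v))

  ~-sym : ∀ {S T : Vec Bool d} → S ~ T → T ~ S
  ~-sym {S} (a , e) = inv a , trans (cong (P^ (inv a)) (sym e)) (P^-inv a S)

  ~-trans : ∀ {S T U : Vec Bool d} → S ~ T → T ~ U → S ~ U
  ~-trans {S} (a , e) (b , e′) = b + a , trans (P^-+ b a S) (trans (cong (P^ b) e) e′)

  minRotation : Vec Bool d → ℕ → Vec Bool d
  minRotation S zero = S
  minRotation S (suc m) = lexMin (minRotation S m) (P^ m S)

  minRotation-~ : ∀ S m → S ~ minRotation S m
  minRotation-~ S zero = 0 , refl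
  minRotation-~ S (suc m) with lexMin-sel (minRotation S m) (P^ m S)
  ... | inj₁ e = subst (S ~_) (sym e) (minRotation-~ S m)
  ... | inj₂ e = m , sym e

  minRotation-≤ : ∀ S m k → k < m → lex≤ (minRotation S m) (P^ k S) ≡ true
  minRotation-≤ S (suc m) k k<1+m with m≤n⇒m<n∨m≡n (≤-pred k<1+m)
  ... | inj₁ k<m = lex≤-trans (minRotation S (suc m)) (minRotation S m) (P^ k S) (lexMin-≤ˡ (minRotation S m) (P^ m S)) (minRotation-≤ S m k k<m)
  ... | inj₂ refl = lexMin-≤ʳ (minRotation S m) (P^ m S)

  canon : Vec Bool d → Vec Bool d
  canon S = minRotation S d

  canon-~ : ∀ S → S ~ canon S
  canon-~ S = minRotation-~ S d

  canon-≤ : ∀ S k → lex≤ (canon S) (P^ k S) ≡ true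
  canon-≤ S k = subst (λ x → lex≤ (canon S) x ≡ true) (sym (P^-% k S)) (minRotation-≤ S d (k % d) (m%n<n k d))

  canon-≤-~ : ∀ {S T} → S ~ T → lex≤ (canon S) T ≡ true
  canon-≤-~ {S} (k , e) = subst (λ x → lex≤ (canon S) x ≡ true) e (canon-≤ S k)

  canon-cong : ∀ {S T} → S ~ T → canon S ≡ canon T
  canon-cong {S} {T} S~T = lex≤-antisym (canon S) (canon T)
    (canon-≤-~ (~-trans S~T (canon-~ T))) (canon-≤-~ (~-trans (~-sym S~T) (canon-~ S)))

  canon-injective : ∀ {S T} → canon S ≡ canon T → S ~ T
  canon-injective {S} {T} e = ~-trans (canon-~ S) (subst (_~ T) (sym e) (~-sym (canon-~ T)))

  IsNecklace : Vec Bool d → Set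
  IsNecklace C = ∀ k → ¬ LexLt (P^ k C) C

  canon-necklace : ∀ S → IsNecklace (canon S)
  canon-necklace S k lt with trans (sym (canon-≤-~ (~-trans (canon-~ S) (k , refl))))
                                  (LexLt⇒lex≰ (P^ k (canon S)) (canon S) lt)
  ... | ()

module Necklaces (d' : ℕ) where
  open Cyclic d'

  necklace-no-smaller-shift : ∀ C → IsNecklace C → ∀ r j → j < d →
    (∀ i → i < j → bit C (i + r) ≡ bit C i) → bit C (j + r) ≡ false → bit C j ≡ true → ⊥
  necklace-no-smaller-shift C nec r j j<d agree Cjr Cj = nec (inv r)
    (j , j<d , (λ i i<j → via-bit (<-trans i<j j<d) (trans (bit-P^-inv r C i) (trans (agree i i<j) (bit-< C i (<-trans i<j j<d)))))
           , via-bit j<d (trans (bit-P^-inv r C j) Cjr) , trans (sym (bit-< C j j<d)) Cj)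
    where
    via-bit : ∀ {i x} → i < d → bit (P^ (inv r) C) i ≡ x → P^ (inv r) C ! i ≡ x
    via-bit {i} i<d e = trans (sym (bit-< (P^ (inv r) C) i i<d)) e

  firstOne : Vec Bool d → ℕ
  firstOne C with firstTrue (bit C) d
  ... | inj₁ (i , _) = i
  ... | inj₂ _ = 0

  module NecklaceOfWeight (C : Vec Bool d) (s : ℕ) (∣C∣≡s : ∣ C ∣ ≡ s) (1≤s : 1 ≤ s) (s<d : s < d)
                          (nec : IsNecklace C) where

    count-bit : count (bit C) d ≡ s
    count-bit = trans (count-ext _ _ d (bit-< C)) (trans (sym (∣∣≡count C)) ∣C∣≡s)

    private
      firstOne-spec : firstOne C < d × bit C (firstOne C) ≡ true × (∀ i → i < firstOne C → bit C i ≡ false)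
      firstOne-spec with firstTrue (bit C) d
      ... | inj₁ (i , i<d , Ci , h) = i<d , Ci , h
      ... | inj₂ h = ⊥-elim (<-irrefl (trans (sym (count-all-false _ d h)) count-bit) 1≤s)

    firstOne<d : firstOne C < d
    firstOne<d = proj₁ firstOne-spec

    bit-firstOne : bit C (firstOne C) ≡ true
    bit-firstOne = proj₁ (proj₂ firstOne-spec)

    bit-<firstOne : ∀ i → i < firstOne C → bit C i ≡ false
    bit-<firstOne = proj₂ (proj₂ firstOne-spec)

    -- C starts with firstOne C zeros, so a longer cyclic run of zeros would give a smaller rotation.
    one-in-window : ∀ r → Σ ℕ λ i → i ≤ firstOne C × bit C (r + i) ≡ true
    one-in-window r with firstTrue (λ i → bit C (r + i)) (suc (firstOne C))
    ... | inj₁ (i , i<1+L , Cri , _) = i , ≤-pred i<1+L , Cri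
    ... | inj₂ h = ⊥-elim (necklace-no-smaller-shift C nec r (firstOne C) firstOne<d
          (λ i i<L → trans (cong (bit C) (+-comm i r)) (trans (h i (m<n⇒m<1+n i<L)) (sym (bit-<firstOne i i<L))))
          (trans (cong (bit C) (+-comm (firstOne C) r)) (h (firstOne C) ≤-refl)) bit-firstOne)

    some-zero : Σ ℕ λ j → j < d × bit C j ≡ false
    some-zero with firstTrue (λ i → not (bit C i)) d
    ... | inj₁ (j , j<d , e , _) = j , j<d , not-injective e
    ... | inj₂ h = ⊥-elim (<-irrefl (trans (sym count-bit) (count-all-true _ d (λ i i<d → not-injective (h i i<d)))) s<d)

    bit-0 : bit C 0 ≡ false
    bit-0 with bit C 0 in C0
    ... | false = refl
    ... | true with some-zero
    ...   | j , j<d , Cj = ⊥-elim (necklace-no-smaller-shift C nec j 0 z<s (λ i ()) Cj C0)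

    bit-last : bit C d' ≡ true
    bit-last with one-in-window d'
    ... | zero , _ , e = trans (cong (bit C) (sym (+-identityʳ d'))) e
    ... | suc i , i<L , e = ⊥-elim (true≢false (trans (sym (begin
      bit C i              ≡⟨ sym (bit-+d C i) ⟩
      bit C (i + d)        ≡⟨ cong (bit C) (trans (+-comm i d) (sym (+-suc d' i))) ⟩
      bit C (d' + suc i)   ≡⟨ e ⟩
      true                 ∎)) (bit-<firstOne i i<L)))
      where open ≡-Reasoning

  private
    leastPeriod : ∀ (C : Vec Bool d) → Least (λ c → P^ (suc c) C ≡ C) d'
    leastPeriod C = least (λ c → P^ (suc c) C ≡ C) (λ c → ≡-dec Data.Bool._≟_ (P^ (suc c) C) C) d'

    period-1 : Vec Bool d → ℕ
    period-1 C with leastPeriod C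
    ... | inj₁ (c , _) = c
    ... | inj₂ _ = d'

  period : Vec Bool d → ℕ
  period C = suc (period-1 C)

  period-spec : ∀ C → period C ≤ d × IsBlockSize C (period C)
  period-spec C with leastPeriod C
  ... | inj₁ (c , c<d' , Cc , h) = s≤s (<⇒≤ c<d') , z<s , Cc , below
    where
    below : ∀ c′ → 0 < c′ → c′ < suc c → P^ c′ C ≢ C
    below (suc c′) _ c′<c = h c′ (≤-pred c′<c)
  ... | inj₂ h = ≤-refl , z<s , P^-d C , below
    where
    below : ∀ c′ → 0 < c′ → c′ < d → P^ c′ C ≢ C
    below (suc c′) _ c′<d' = h c′ (≤-pred c′<d')

  P^-period : ∀ C → P^ (period C) C ≡ C
  P^-period C = proj₁ (proj₂ (proj₂ (period-spec C)))

  bit-+period : ∀ C i → bit C (i + period C) ≡ bit C i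
  bit-+period C i = trans (cong (λ x → bit x (i + period C)) (sym (P^-period C))) (bit-P^ (period C) C i)

  bit-+*period : ∀ C i k → bit C (i + k * period C) ≡ bit C i
  bit-+*period C i zero = cong (bit C) (+-identityʳ i)
  bit-+*period C i (suc k) = begin
    bit C (i + (period C + k * period C)) ≡⟨ cong (bit C) (trans (cong (i +_) (+-comm (period C) _)) (sym (+-assoc i _ _))) ⟩
    bit C (i + k * period C + period C)   ≡⟨ bit-+period C (i + k * period C) ⟩
    bit C (i + k * period C)              ≡⟨ bit-+*period C i k ⟩
    bit C i                               ∎
    where open ≡-Reasoning

  bit-%period : ∀ C i → bit C i ≡ bit C (i % period C)
  bit-%period C i = trans (cong (bit C) (m≡m%n+[m/n]*n i (period C))) (bit-+*period C (i % period C) (i / period C))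

  -- If d % period C were nonzero, it would be a smaller period.
  period∣d : ∀ C → d % period C ≡ 0
  period∣d C with d % period C in e
  ... | zero = refl
  ... | suc r = ⊥-elim (proj₂ (proj₂ (proj₂ (period-spec C))) (suc r) z<s (subst (_< period C) e (m%n<n d (period C)))
                   (bit-ext _ _ λ i _ → begin
                     bit (P^ (suc r) C) i              ≡⟨ bit-P^-≤ (suc r) C i (subst (_≤ d) e (m%n≤m d (period C))) ⟩
                     bit C (i + (d ∸ suc r))           ≡⟨ cong (λ x → bit C (i + (d ∸ x))) (sym e) ⟩
                     bit C (i + (d ∸ d % period C))    ≡⟨ cong (λ x → bit C (i + x)) d∸d%p ⟩
                     bit C (i + d / period C * period C) ≡⟨ bit-+*period C i (d / period C) ⟩
                     bit C i                           ∎))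
    where
    open ≡-Reasoning
    d∸d%p : d ∸ d % period C ≡ d / period C * period C
    d∸d%p = trans (cong (d ∸_) (m%n≡m∸m/n*n d (period C))) (m∸[m∸n]≡n (m/n*n≤m d (period C)))

  blocks : Vec Bool d → ℕ
  blocks C = d / period C

  blocks*period : ∀ C → blocks C * period C ≡ d
  blocks*period C = sym (trans (m≡m%n+[m/n]*n d (period C)) (cong (_+ blocks C * period C) (period∣d C)))

  IsBlockSize-~ : ∀ {S T : Vec Bool d} {b} → S ~ T → IsBlockSize S b → IsBlockSize T b
  IsBlockSize-~ {S} {T} {b} (a , refl) (0<b , Sb , least-b) =
    0<b , trans (P^-comm b a S) (cong (P^ a) Sb) , λ c 0<c c<b Tc → least-b c 0<c c<b (P^-injective a _ _ (trans (P^-comm a c S) Tc))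

  P^-∸-fixed : ∀ S a c → a ≤ c → P^ a S ≡ P^ c S → P^ (c ∸ a) S ≡ S
  P^-∸-fixed S a c a≤c e = P^-injective a _ _ (begin
    P^ a (P^ (c ∸ a) S) ≡⟨ sym (P^-+ a (c ∸ a) S) ⟩
    P^ (a + (c ∸ a)) S  ≡⟨ cong (λ x → P^ x S) (m+[n∸m]≡n a≤c) ⟩
    P^ c S              ≡⟨ sym e ⟩
    P^ a S              ∎)
    where open ≡-Reasoning

  aperiodic⇒regular : ∀ S → (∀ c → 0 < c → c < d → P^ c S ≢ S) → Regular S
  aperiodic⇒regular S h i j e with <-cmp (toℕ i) (toℕ j)
  ... | tri≈ _ i≡j _ = toℕ-injective i≡j
  ... | tri< i<j _ _ = ⊥-elim (h (toℕ j ∸ toℕ i) (m<n⇒0<n∸m i<j) (≤-<-trans (m∸n≤m (toℕ j) (toℕ i)) (toℕ<n j))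
                                (P^-∸-fixed S (toℕ i) (toℕ j) (<⇒≤ i<j) e))
  ... | tri> _ _ j<i = ⊥-elim (h (toℕ i ∸ toℕ j) (m<n⇒0<n∸m j<i) (≤-<-trans (m∸n≤m (toℕ i) (toℕ j)) (toℕ<n i))
                                (P^-∸-fixed S (toℕ j) (toℕ i) (<⇒≤ j<i) (sym e)))

  Regular-~ : ∀ {S T : Vec Bool d} → S ~ T → Regular T → Regular S
  Regular-~ {S} (a , refl) reg i j e =
    reg i j (trans (P^-comm (toℕ i) a S) (trans (cong (P^ a) e) (sym (P^-comm (toℕ j) a S))))

  -- T is lexicographically strictly smaller than its rotation to the left by r.
  LyndonAt : Vec Bool d → ℕ → Set
  LyndonAt T r = Σ ℕ λ j → (∀ i → i < j → bit T i ≡ bit T (i + r)) × bit T j ≡ false × bit T (j + r) ≡ true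

  Lyndon : Vec Bool d → Set
  Lyndon T = ∀ r → 0 < r → r < d → LyndonAt T r

  -- T′ = P^ k T would be both strictly smaller and strictly larger than T.
  Lyndon-rotation-≢ : ∀ T T′ → Lyndon T → Lyndon T′ → ∀ k → 0 < k → k < d → P^ k T ≢ T′
  Lyndon-rotation-≢ T T′ lyn lyn′ k 0<k k<d refl
    with lyn (d ∸ k) (m<n⇒0<n∸m k<d) (∸-monoʳ-< 0<k (<⇒≤ k<d)) | lyn′ k 0<k k<d
  ... | j , agree , Tj , Tjr | j′ , agree′ , T′j′ , T′j′k with <-cmp j j′
  ... | tri< j<j′ _ _ = true≢false (trans (sym Tjr) (trans (sym (bit-P^-≤ k T j (<⇒≤ k<d))) (trans (agree′ j j<j′) (trans (bit-P^ k T j) Tj))))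
  ... | tri≈ _ refl _ = true≢false (trans (sym T′j′k) (trans (bit-P^ k T j) Tj))
  ... | tri> _ _ j′<j = true≢false (trans (sym T′j′k) (trans (bit-P^ k T j′) (trans (agree j′ j′<j) (trans (sym (bit-P^-≤ k T j′ (<⇒≤ k<d))) T′j′))))

  Lyndon⇒Regular : ∀ T → Lyndon T → Regular T
  Lyndon⇒Regular T lyn = aperiodic⇒regular T (λ c 0<c c<d → Lyndon-rotation-≢ T T lyn lyn c 0<c c<d)

  Lyndon-~⇒≡ : ∀ T T′ → Lyndon T → Lyndon T′ → T ~ T′ → T ≡ T′
  Lyndon-~⇒≡ T T′ lyn lyn′ (k , e) with k % d in k%d
  ... | zero = trans (sym (trans (P^-% k T) (cong (λ x → P^ x T) k%d))) e
  ... | suc r = ⊥-elim (Lyndon-rotation-≢ T T′ lyn lyn′ (suc r) z<s (subst (_< d) k%d (m%n<n k d))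
                         (trans (cong (λ x → P^ x T) (sym k%d)) (trans (sym (P^-% k T)) e)))

  LyndonAt-from-zeros : ∀ T r m → (∀ i → i < m → bit T i ≡ false) → (Σ ℕ λ i → i < m × bit T (i + r) ≡ true) →
                        LyndonAt T r
  LyndonAt-from-zeros T r m zeros (i₀ , i₀<m , T[i₀+r]) with firstTrue (λ i → bit T (i + r)) m
  ... | inj₁ (j , j<m , Tjr , h) = j , (λ i i<j → trans (zeros i (<-trans i<j j<m)) (sym (h i i<j))) , zeros j j<m , Tjr
  ... | inj₂ h = ⊥-elim (true≢false (trans (sym T[i₀+r]) (h i₀ i₀<m)))

  LeadingRun : Vec Bool d → ℕ → ℕ → Set
  LeadingRun T a u = (∀ i → i < a → bit T i ≡ false) × (∀ i → a ≤ i → i < a + u → bit T i ≡ true) × bit T (a + u) ≡ false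

  LeadingRun-unique : ∀ {T a u a′ u′} → 0 < u → 0 < u′ → LeadingRun T a u → LeadingRun T a′ u′ → a ≡ a′ × u ≡ u′
  LeadingRun-unique {T} {a} {u} {a′} {u′} 0<u 0<u′ (zeros , ones , end) (zeros′ , ones′ , end′) with <-cmp a a′
  ... | tri< a<a′ _ _ = ⊥-elim (true≢false (trans (sym (ones a ≤-refl (m<m+n a 0<u))) (zeros′ a a<a′)))
  ... | tri> _ _ a′<a = ⊥-elim (true≢false (trans (sym (ones′ a′ ≤-refl (m<m+n a′ 0<u′))) (zeros a′ a′<a)))
  ... | tri≈ _ refl _ with <-cmp u u′
  ...   | tri≈ _ u≡u′ _ = refl , u≡u′
  ...   | tri< u<u′ _ _ = ⊥-elim (true≢false (trans (sym (ones′ (a + u) (m≤m+n a u) (+-monoʳ-< a u<u′))) end))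
  ...   | tri> _ _ u′<u = ⊥-elim (true≢false (trans (sym (ones (a + u′) (m≤m+n a u′) (+-monoʳ-< a u′<u))) end′))

module Families (d' : ℕ) where
  open Cyclic d'
  open Necklaces d'

  ones : Vec Bool d → ℕ
  ones C = count (bit C) (period C)

  zeros : Vec Bool d → ℕ
  zeros C = period C ∸ ones C

  sortBlocks : Vec Bool d → ℕ → ℕ → Bool
  sortBlocks C k i = if does (i <? k * period C) then step (zeros C) (i % period C) else bit C i

  -- Moves the zero of C at position k · b, the start of a block, to the front.
  shiftBlocks : Vec Bool d → ℕ → ℕ → Bool
  shiftBlocks C k zero = false
  shiftBlocks C k (suc i) = if does (suc i ≤? k * period C) then bit C i else bit C (suc i)

  zerosOnes : ℕ → ℕ → Bool
  zerosOnes s = step (d ∸ s)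

  module ZerosOnes {s} (1≤s : 1 ≤ s) (s<d : s < d) where
    T : Vec Bool d
    T = build (zerosOnes s) d

    1≤d∸s : 1 ≤ d ∸ s
    1≤d∸s = m<n⇒0<n∸m s<d

    d∸s+s≡d : d ∸ s + s ≡ d
    d∸s+s≡d = m∸n+n≡m (<⇒≤ s<d)

    bit-T : ∀ i → i < d → bit T i ≡ step (d ∸ s) i
    bit-T i i<d = trans (bit-< T i i<d) (build-! (zerosOnes s) d i i<d)

    leadingRun : LeadingRun T (d ∸ s) s
    leadingRun = zeros-T
               , (λ i d∸s≤i i<d → trans (bit-T i (subst (i <_) d∸s+s≡d i<d)) (step-≥ (d ∸ s) d∸s≤i))
               , trans (cong (bit T) d∸s+s≡d) (trans (bit-+d T 0) (zeros-T 0 1≤d∸s))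
      where
      zeros-T : ∀ i → i < d ∸ s → bit T i ≡ false
      zeros-T i i<d∸s = trans (bit-T i (<-≤-trans i<d∸s (m∸n≤m d s))) (step-< (d ∸ s) i<d∸s)

    ∣T∣ : ∣ T ∣ ≡ s
    ∣T∣ = trans (∣build∣ (zerosOnes s) d) (trans (cong (count (zerosOnes s)) (sym d∸s+s≡d)) (count-step (d ∸ s) s))

    lyndon : Lyndon T
    lyndon r 0<r r<d with d ∸ s ≤? r
    ... | yes d∸s≤r = LyndonAt-from-zeros T r (d ∸ s) (proj₁ leadingRun) (0 , 1≤d∸s , trans (bit-T r r<d) (step-≥ (d ∸ s) d∸s≤r))
    ... | no d∸s≰r = LyndonAt-from-zeros T r (d ∸ s) (proj₁ leadingRun) ((d ∸ s) ∸ r , ∸-monoʳ-< 0<r (<⇒≤ (≰⇒> d∸s≰r)) ,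
                       trans (cong (bit T) (m∸n+n≡m (<⇒≤ (≰⇒> d∸s≰r))))
                         (trans (bit-T (d ∸ s) (∸-monoʳ-< {o = 0} 1≤s (<⇒≤ s<d))) (step-≥ (d ∸ s) ≤-refl)))

  family : ℕ → Vec Bool d → ℕ → Vec Bool d
  family s C k with firstOne C <? zeros C | zeros C ≟ 1 | k ≟ 1
  ... | yes _ | _ | _ = build (sortBlocks C k) d
  ... | no _ | yes _ | yes _ = build (zerosOnes s) d
  ... | no _ | _ | _ = build (shiftBlocks C k) d

  data FamilyView (s : ℕ) (C : Vec Bool d) (k : ℕ) (T : Vec Bool d) : Set where
    sorted : firstOne C < zeros C → T ≡ build (sortBlocks C k) d → FamilyView s C k T
    extreme : zeros C ≤ firstOne C → zeros C ≡ 1 → k ≡ 1 → T ≡ build (zerosOnes s) d → FamilyView s C k T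
    shifted : zeros C ≤ firstOne C → (zeros C ≡ 1 → k ≡ 1 → ⊥) → T ≡ build (shiftBlocks C k) d → FamilyView s C k T

  familyView : ∀ s C k → FamilyView s C k (family s C k)
  familyView s C k with firstOne C <? zeros C | zeros C ≟ 1 | k ≟ 1
  ... | yes L<z | _ | _ = sorted L<z refl
  ... | no L≮z | yes z≡1 | yes k≡1 = extreme (≮⇒≥ L≮z) z≡1 k≡1 refl
  ... | no L≮z | yes _ | no k≢1 = shifted (≮⇒≥ L≮z) (λ _ k≡1 → k≢1 k≡1) refl
  ... | no L≮z | no z≢1 | _ = shifted (≮⇒≥ L≮z) (λ z≡1 _ → z≢1 z≡1) refl

  module SpecialNecklace (C : Vec Bool d) (s : ℕ) (∣C∣≡s : ∣ C ∣ ≡ s) (1≤s : 1 ≤ s) (s<d : s < d)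
                         (nec : IsNecklace C) (special : ¬ Regular C) where
    open NecklaceOfWeight C s ∣C∣≡s 1≤s s<d nec public

    b : ℕ
    b = period C
    n : ℕ
    n = blocks C
    t : ℕ
    t = ones C
    z : ℕ
    z = zeros C
    L : ℕ
    L = firstOne C

    b≤d : b ≤ d
    b≤d = proj₁ (period-spec C)

    b<d : b < d
    b<d with m≤n⇒m<n∨m≡n b≤d
    ... | inj₁ b<d = b<d
    ... | inj₂ b≡d = ⊥-elim (special (aperiodic⇒regular C λ c 0<c c<d →
            proj₂ (proj₂ (proj₂ (period-spec C))) c 0<c (subst (c <_) (sym b≡d) c<d)))

    n*b≡d : n * b ≡ d
    n*b≡d = blocks*period C

    2≤n : 2 ≤ n
    2≤n with n | n*b≡d
    ... | zero | e = ⊥-elim (0≢1+n e)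
    ... | suc zero | e = ⊥-elim (<-irrefl (trans (sym (+-identityʳ b)) e) b<d)
    ... | suc (suc _) | _ = s≤s (s≤s z≤n)

    s≡n*t : s ≡ n * t
    s≡n*t = trans (sym count-bit) (trans (cong (count (bit C)) (sym n*b≡d)) (count-periodic (bit C) b (bit-+period C) n))

    t*d≡s*b : t * d ≡ s * b
    t*d≡s*b = begin
      t * d       ≡⟨ cong (t *_) (sym n*b≡d) ⟩
      t * (n * b) ≡⟨ sym (*-assoc t n b) ⟩
      t * n * b   ≡⟨ cong (_* b) (*-comm t n) ⟩
      n * t * b   ≡⟨ cong (_* b) (sym s≡n*t) ⟩
      s * b       ∎
      where open ≡-Reasoning

    t≤b : t ≤ b
    t≤b = count≤ (bit C) b

    1≤t : 1 ≤ t
    1≤t with t in e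
    ... | zero = ⊥-elim (<-irrefl (sym (trans s≡n*t (trans (cong (n *_) e) (*-zeroʳ n)))) 1≤s)
    ... | suc _ = s≤s z≤n

    t<b : t < b
    t<b with m≤n⇒m<n∨m≡n t≤b
    ... | inj₁ t<b = t<b
    ... | inj₂ t≡b = ⊥-elim (<-irrefl (trans s≡n*t (trans (cong (n *_) t≡b) n*b≡d)) s<d)

    1≤z : 1 ≤ z
    1≤z = m<n⇒0<n∸m t<b

    z+t≡b : z + t ≡ b
    z+t≡b = m∸n+n≡m t≤b

    z<b : z < b
    z<b = subst (z <_) z+t≡b (m<m+n z 1≤t)

    2≤b : 2 ≤ b
    2≤b = subst (2 ≤_) z+t≡b (+-mono-≤ 1≤z 1≤t)

    b+b≤d : b + b ≤ d
    b+b≤d = subst₂ _≤_ (cong (b +_) (+-identityʳ b)) n*b≡d (*-monoˡ-≤ b 2≤n)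

    L<b : L < b
    L<b with L <? b
    ... | yes L<b = L<b
    ... | no L≮b = ⊥-elim (true≢false (trans (sym bit-firstOne) (begin
      bit C L             ≡⟨ cong (bit C) (sym (m∸n+n≡m (≮⇒≥ L≮b))) ⟩
      bit C (L ∸ b + b)   ≡⟨ bit-+period C (L ∸ b) ⟩
      bit C (L ∸ b)       ≡⟨ bit-<firstOne (L ∸ b) (∸-monoʳ-< {o = 0} z<s (≮⇒≥ L≮b)) ⟩
      false               ∎)))
      where open ≡-Reasoning

    [q*b+x]%b≡x : ∀ q x → x < b → (q * b + x) % b ≡ x
    [q*b+x]%b≡x q x x<b = trans (cong (_% b) (+-comm (q * b) x)) (trans ([m+kn]%n≡m%n x q b) (m<n⇒m%n≡m x<b))

    k*b+b≤d : ∀ {k} → k < n → k * b + b ≤ d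
    k*b+b≤d {k} k<n = subst (_≤ d) (+-comm b (k * b)) (subst (suc k * b ≤_) n*b≡d (*-monoˡ-≤ b k<n))

    b≤k*b : ∀ {k} → 1 ≤ k → b ≤ k * b
    b≤k*b {k} 1≤k = subst₂ _≤_ (*-identityʳ b) (*-comm b k) (*-monoʳ-≤ b 1≤k)

    private
      bit-sorted-< : z ≤ L → ∀ j → j < b → bit C j ≡ step z j
      bit-sorted-< z≤L j j<b with j <? z
      ... | yes j<z = trans (bit-<firstOne j (≤-trans j<z z≤L)) (sym (step-< z j<z))
      ... | no j≮z = trans bit-j (sym (step-≥ z (≮⇒≥ j≮z)))
        where
        ones-after-z : count (λ i → bit C (z + i)) t ≡ t
        ones-after-z = begin
          count (λ i → bit C (z + i)) t                  ≡⟨ cong (_+ count (λ i → bit C (z + i)) t)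
                                                             (sym (count-all-false (bit C) z (λ i i<z → bit-<firstOne i (≤-trans i<z z≤L)))) ⟩
          count (bit C) z + count (λ i → bit C (z + i)) t ≡⟨ sym (count-+ (bit C) z t) ⟩
          count (bit C) (z + t)                          ≡⟨ cong (count (bit C)) z+t≡b ⟩
          t                                              ∎
          where open ≡-Reasoning
        bit-j : bit C j ≡ true
        bit-j = trans (cong (bit C) (sym (m+[n∸m]≡n (≮⇒≥ j≮z))))
                  (count≡m⇒all (λ i → bit C (z + i)) t ones-after-z (j ∸ z)
                     (subst (j ∸ z <_) (m+n∸m≡n z t) (∸-monoˡ-< (subst (j <_) (sym z+t≡b) j<b) (≮⇒≥ j≮z))))

    bit-sorted : z ≤ L → ∀ i → bit C i ≡ step z (i % b)
    bit-sorted z≤L i = trans (bit-%period C i) (bit-sorted-< z≤L (i % b) (m%n<n i b))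

    L≡z : z ≤ L → L ≡ z
    L≡z z≤L with <-cmp z L
    ... | tri≈ _ z≡L _ = sym z≡L
    ... | tri> _ _ L<z = ⊥-elim (<⇒≱ L<z z≤L)
    ... | tri< z<L _ _ = ⊥-elim (true≢false (trans (sym (trans (bit-sorted-< z≤L z z<b) (step-≥ z ≤-refl))) (bit-<firstOne z z<L)))

    module Sorted {k} (1≤k : 1 ≤ k) (k<n : k < n) (L<z : L < z) where
      T : Vec Bool d
      T = build (sortBlocks C k) d

      k*b<d : k * b < d
      k*b<d = <-≤-trans (m<m+n (k * b) (<-≤-trans z<s (≤-trans 1≤t t≤b))) (k*b+b≤d k<n)

      bit-T : ∀ i → i < d → bit T i ≡ sortBlocks C k i
      bit-T i i<d = trans (bit-< T i i<d) (build-! (sortBlocks C k) d i i<d)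

      bit-T-sorted : ∀ i → i < k * b → bit T i ≡ step z (i % b)
      bit-T-sorted i i<kb = trans (bit-T i (<-trans i<kb k*b<d)) (if-yes (i <? k * b) i<kb)

      bit-T-kept : ∀ i → k * b ≤ i → i < d → bit T i ≡ bit C i
      bit-T-kept i kb≤i i<d = trans (bit-T i i<d) (if-no (i <? k * b) (≤⇒≯ kb≤i))

      bit-T-<b : ∀ i → i < b → bit T i ≡ step z i
      bit-T-<b i i<b = trans (bit-T-sorted i (<-≤-trans i<b (b≤k*b 1≤k))) (cong (step z) (m<n⇒m%n≡m i<b))

      leadingRun : LeadingRun T z t
      leadingRun = (λ i i<z → trans (bit-T-<b i (<-trans i<z z<b)) (step-< z i<z))
                 , (λ i z≤i i<z+t → trans (bit-T-<b i (subst (i <_) z+t≡b i<z+t)) (step-≥ z z≤i))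
                 , trans (cong (bit T) z+t≡b) (bit-T-b (b <? k * b))
        where
        bit-T-b : Dec (b < k * b) → bit T b ≡ false
        bit-T-b (yes b<kb) = trans (bit-T-sorted b b<kb) (trans (cong (step z) (n%n≡0 b)) (step-< z 1≤z))
        bit-T-b (no b≮kb) = trans (bit-T-kept b (≮⇒≥ b≮kb) b<d) (trans (bit-+period C 0) bit-0)

      ∣T∣ : ∣ T ∣ ≡ s
      ∣T∣ = begin
        ∣ T ∣                                                   ≡⟨ ∣build∣ (sortBlocks C k) d ⟩
        count g d                                               ≡⟨ cong (count g) (sym d≡kb+rest) ⟩
        count g (k * b + (n ∸ k) * b)                           ≡⟨ count-+ g (k * b) ((n ∸ k) * b) ⟩
        count g (k * b) + count (λ i → g (k * b + i)) ((n ∸ k) * b) ≡⟨ cong₂ _+_ sorted-part kept-part ⟩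
        k * t + (n ∸ k) * t                                     ≡⟨ sym (*-distribʳ-+ t k (n ∸ k)) ⟩
        (k + (n ∸ k)) * t                                       ≡⟨ cong (_* t) (m+[n∸m]≡n (<⇒≤ k<n)) ⟩
        n * t                                                   ≡⟨ sym s≡n*t ⟩
        s                                                       ∎
        where
        open ≡-Reasoning
        g : ℕ → Bool
        g = sortBlocks C k
        d≡kb+rest : k * b + (n ∸ k) * b ≡ d
        d≡kb+rest = trans (sym (*-distribʳ-+ b k (n ∸ k))) (trans (cong (_* b) (m+[n∸m]≡n (<⇒≤ k<n))) n*b≡d)
        sorted-block : ℕ → Bool
        sorted-block i = step z (i % b)
        sorted-part : count g (k * b) ≡ k * t
        sorted-part = begin
          count g (k * b)            ≡⟨ count-ext g sorted-block (k * b) (λ i i<kb → if-yes (i <? k * b) i<kb) ⟩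
          count sorted-block (k * b) ≡⟨ count-periodic sorted-block b (λ i → cong (step z) ([m+n]%n≡m%n i b)) k ⟩
          k * count sorted-block b   ≡⟨ cong (k *_) (count-ext _ (step z) b (λ i i<b → cong (step z) (m<n⇒m%n≡m i<b))) ⟩
          k * count (step z) b       ≡⟨ cong (λ x → k * count (step z) x) (sym z+t≡b) ⟩
          k * count (step z) (z + t) ≡⟨ cong (k *_) (count-step z t) ⟩
          k * t                      ∎
        kept-part : count (λ i → g (k * b + i)) ((n ∸ k) * b) ≡ (n ∸ k) * t
        kept-part = trans (count-ext _ (bit C) ((n ∸ k) * b)
                            (λ i _ → trans (if-no ((k * b + i) <? k * b) (≤⇒≯ (m≤m+n (k * b) i)))
                                           (trans (cong (bit C) (+-comm (k * b) i)) (bit-+*period C i k))))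
                          (count-periodic (bit C) b (bit-+period C) (n ∸ k))

      private
        zeros-T : ∀ i → i < z → bit T i ≡ false
        zeros-T = proj₁ leadingRun

      -- The unchanged part of C has a one in every window of length L + 1 ≤ z.
      lyndonAt-kept : ∀ r → k * b ≤ r → r < d → LyndonAt T r
      lyndonAt-kept r kb≤r r<d with one-in-window r
      ... | i₀ , i₀≤L , C[r+i₀] with r + i₀ <? d
      ...   | yes r+i₀<d = LyndonAt-from-zeros T r z zeros-T (i₀ , ≤-<-trans i₀≤L L<z ,
                  trans (cong (bit T) (+-comm i₀ r)) (trans (bit-T-kept (r + i₀) (≤-trans kb≤r (m≤m+n r i₀)) r+i₀<d) C[r+i₀]))
      ...   | no r+i₀≮d = LyndonAt-from-zeros T r z zeros-T (d' ∸ r , d'∸r<z ,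
                  trans (cong (bit T) (m∸n+n≡m (≤-pred r<d))) (trans (bit-T-kept d' (≤-trans kb≤r (≤-pred r<d)) ≤-refl) bit-last))
        where
        d'∸r<z : d' ∸ r < z
        d'∸r<z = <-≤-trans (+-cancelˡ-< r (d' ∸ r) i₀ (subst (_< r + i₀) (sym (m+[n∸m]≡n (≤-pred r<d))) (≮⇒≥ r+i₀≮d)))
                           (<⇒≤ (≤-<-trans i₀≤L L<z))

      -- Inside the sorted prefix a shift not divisible by b meets the ones of some sorted block within z steps.
      lyndonAt-unaligned : ∀ r → r < k * b → r % b ≢ 0 → LyndonAt T r
      lyndonAt-unaligned r r<kb r%b≢0 with z ≤? r % b
      ... | yes z≤o = LyndonAt-from-zeros T r z zeros-T (0 , 1≤z , trans (bit-T-sorted r r<kb) (step-≥ z z≤o))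
      ... | no z≰o = LyndonAt-from-zeros T r z zeros-T (z ∸ o , ∸-monoʳ-< {o = 0} (n≢0⇒n>0 r%b≢0) (<⇒≤ (≰⇒> z≰o)) ,
                        trans (cong (bit T) shift) (trans (bit-T-sorted (z + q * b) z+qb<kb)
                          (trans (cong (step z) (trans (cong (_% b) (+-comm z (q * b))) ([q*b+x]%b≡x q z z<b))) (step-≥ z ≤-refl))))
        where
        o : ℕ
        o = r % b
        q : ℕ
        q = r / b
        shift : (z ∸ o) + r ≡ z + q * b
        shift = begin
          (z ∸ o) + r           ≡⟨ cong ((z ∸ o) +_) (m≡m%n+[m/n]*n r b) ⟩
          (z ∸ o) + (o + q * b) ≡⟨ sym (+-assoc (z ∸ o) o (q * b)) ⟩
          (z ∸ o) + o + q * b   ≡⟨ cong (_+ q * b) (m∸n+n≡m (<⇒≤ (≰⇒> z≰o))) ⟩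
          z + q * b             ∎
          where open ≡-Reasoning
        z+qb<kb : z + q * b < k * b
        z+qb<kb = <-≤-trans (+-monoˡ-< (q * b) z<b) (*-monoˡ-≤ b (m<n*o⇒m/o<n {r} {k} {b} r<kb))

      -- A shift by m whole blocks (0 < m < k) first disagrees at offset L of block k − m: a zero of the
      -- sorted block (L < z) is compared with the first one of the kept block k.
      module AlignedShift {q m} (1≤m : 1 ≤ m) (q+m≡k : q + m ≡ k) where
        r : ℕ
        r = m * b
        j : ℕ
        j = q * b + L

        qb+r≡kb : q * b + r ≡ k * b
        qb+r≡kb = trans (sym (*-distribʳ-+ b q m)) (cong (_* b) q+m≡k)

        j<kb : j < k * b
        j<kb = <-≤-trans (+-monoʳ-< (q * b) L<b) (subst (_≤ k * b) (+-comm b (q * b))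
                 (subst (λ x → suc q * b ≤ x * b) q+m≡k (*-monoˡ-≤ b (subst (suc q ≤_) (+-comm m q) (+-monoˡ-≤ q 1≤m)))))

        bit-T-j : bit T j ≡ false
        bit-T-j = trans (bit-T-sorted j j<kb) (trans (cong (step z) ([q*b+x]%b≡x q L L<b)) (step-< z L<z))

        bit-T-j+r : bit T (j + r) ≡ true
        bit-T-j+r = trans (cong (bit T) j+r≡kb+L)
                      (trans (bit-T-kept (k * b + L) (m≤m+n (k * b) L) (<-≤-trans (+-monoʳ-< (k * b) L<b) (k*b+b≤d k<n)))
                        (trans (cong (bit C) (+-comm (k * b) L)) (trans (bit-+*period C L k) bit-firstOne)))
          where
          j+r≡kb+L : j + r ≡ k * b + L
          j+r≡kb+L = begin
            q * b + L + r   ≡⟨ +-assoc (q * b) L r ⟩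
            q * b + (L + r) ≡⟨ cong (q * b +_) (+-comm L r) ⟩
            q * b + (r + L) ≡⟨ sym (+-assoc (q * b) r L) ⟩
            q * b + r + L   ≡⟨ cong (_+ L) qb+r≡kb ⟩
            k * b + L       ∎
            where open ≡-Reasoning

        agree-sorted : ∀ i → i < q * b → bit T i ≡ bit T (i + r)
        agree-sorted i i<qb = trans (bit-T-sorted i (<-trans i<qb (≤-<-trans (m≤m+n (q * b) L) j<kb)))
          (trans (cong (step z) (sym ([m+kn]%n≡m%n i m b)))
            (sym (bit-T-sorted (i + r) (subst (i + r <_) qb+r≡kb (+-monoˡ-< r i<qb)))))

        agree-kept : ∀ i → q * b ≤ i → i < j → bit T i ≡ bit T (i + r)
        agree-kept i qb≤i i<j = trans (bit-T-sorted i (<-trans i<j j<kb))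
            (trans (cong (step z) i%b≡e) (trans (step-< z (<-trans e<L L<z))
              (sym (trans (bit-T-kept (i + r) kb≤i+r i+r<d)
                     (trans (cong (bit C) i+r≡e+kb) (trans (bit-+*period C e k) (bit-<firstOne e e<L)))))))
          where
          e : ℕ
          e = i ∸ q * b
          i≡qb+e : i ≡ q * b + e
          i≡qb+e = sym (m+[n∸m]≡n qb≤i)
          e<L : e < L
          e<L = +-cancelˡ-< (q * b) e L (subst (_< q * b + L) i≡qb+e i<j)
          i%b≡e : i % b ≡ e
          i%b≡e = trans (cong (_% b) i≡qb+e) ([q*b+x]%b≡x q e (<-trans e<L L<b))
          i+r≡e+kb : i + r ≡ e + k * b
          i+r≡e+kb = begin
            i + r             ≡⟨ cong (_+ r) i≡qb+e ⟩
            q * b + e + r     ≡⟨ cong (_+ r) (+-comm (q * b) e) ⟩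
            e + q * b + r     ≡⟨ +-assoc e (q * b) r ⟩
            e + (q * b + r)   ≡⟨ cong (e +_) qb+r≡kb ⟩
            e + k * b         ∎
            where open ≡-Reasoning
          kb≤i+r : k * b ≤ i + r
          kb≤i+r = subst (k * b ≤_) (sym i+r≡e+kb) (m≤n+m (k * b) e)
          i+r<d : i + r < d
          i+r<d = subst (_< d) (sym i+r≡e+kb)
                    (<-≤-trans (subst (_< k * b + b) (+-comm (k * b) e) (+-monoʳ-< (k * b) (<-trans e<L L<b))) (k*b+b≤d k<n))

        lyndonAt : LyndonAt T r
        lyndonAt = j , agree , bit-T-j , bit-T-j+r
          where
          agree : ∀ i → i < j → bit T i ≡ bit T (i + r)
          agree i i<j with i <? q * b
          ... | yes i<qb = agree-sorted i i<qb
          ... | no i≮qb = agree-kept i (≮⇒≥ i≮qb) i<j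

      lyndonAt-aligned : ∀ r → 0 < r → r < k * b → r % b ≡ 0 → LyndonAt T r
      lyndonAt-aligned r 0<r r<kb r%b≡0 =
        subst (LyndonAt T) (sym r≡m*b) (AlignedShift.lyndonAt {k ∸ m} {m} 1≤m (m∸n+n≡m (<⇒≤ m<k)))
        where
        m : ℕ
        m = r / b
        r≡m*b : r ≡ m * b
        r≡m*b = trans (m≡m%n+[m/n]*n r b) (cong (_+ m * b) r%b≡0)
        m<k : m < k
        m<k = m<n*o⇒m/o<n {r} {k} {b} r<kb
        1≤m : 1 ≤ m
        1≤m with m | r≡m*b
        ... | zero | e = ⊥-elim (<-irrefl (sym e) 0<r)
        ... | suc _ | _ = s≤s z≤n

      lyndon : Lyndon T
      lyndon r 0<r r<d with r <? k * b
      ... | no r≮kb = lyndonAt-kept r (≮⇒≥ r≮kb) r<d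
      ... | yes r<kb with r % b ≟ 0
      ...   | yes r%b≡0 = lyndonAt-aligned r 0<r r<kb r%b≡0
      ...   | no r%b≢0 = lyndonAt-unaligned r r<kb r%b≢0

    module Shifted {k} (1≤k : 1 ≤ k) (k<n : k < n) (z≤L : z ≤ L) (¬z≡1∧k≡1 : z ≡ 1 → k ≡ 1 → ⊥) where
      T : Vec Bool d
      T = build (shiftBlocks C k) d

      k*b<d' : k * b < d'
      k*b<d' = ≤-pred (subst (λ x → suc x ≤ d) (+-comm (k * b) 1) (<-≤-trans (+-monoʳ-< (k * b) 2≤b) (k*b+b≤d k<n)))

      k*b<d : k * b < d
      k*b<d = m<n⇒m<1+n k*b<d'

      L<1+z : ∀ {i} → i ≤ L → i < z + 1
      L<1+z {i} i≤L = subst (i <_) (+-comm 1 z) (s≤s (subst (i ≤_) (L≡z z≤L) i≤L))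

      bit-T : ∀ i → i < d → bit T i ≡ shiftBlocks C k i
      bit-T i i<d = trans (bit-< T i i<d) (build-! (shiftBlocks C k) d i i<d)

      bit-T-shifted : ∀ i → suc i ≤ k * b → bit T (suc i) ≡ bit C i
      bit-T-shifted i i<kb = trans (bit-T (suc i) (≤-<-trans i<kb k*b<d)) (if-yes (suc i ≤? k * b) i<kb)

      bit-T-kept : ∀ i → k * b < i → i < d → bit T i ≡ bit C i
      bit-T-kept (suc i) kb<i i<d = trans (bit-T (suc i) i<d) (if-no (suc i ≤? k * b) (<⇒≱ kb<i))

      bit-C-kb : bit C (k * b) ≡ false
      bit-C-kb = trans (bit-+*period C 0 k) bit-0

      zeros-T : ∀ i → i < z + 1 → bit T i ≡ false
      zeros-T zero _ = bit-T 0 z<s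
      zeros-T (suc i) i<z+1 = trans (bit-T-shifted i (≤-trans i<z (≤-trans (<⇒≤ z<b) (b≤k*b 1≤k))))
                                    (bit-<firstOne i (≤-trans i<z z≤L))
        where
        i<z : i < z
        i<z = ≤-pred (subst (suc (suc i) ≤_) (+-comm z 1) i<z+1)

      -- bit T (b + 1) is the first bit of the second block, or, when k = 1, bit 1 of 0^z 1^t with z ≥ 2.
      leadingRun : LeadingRun T (z + 1) t
      leadingRun = zeros-T , ones-T , trans (cong (bit T) z+1+t≡1+b) (bit-T-1+b (suc b ≤? k * b))
        where
        ones-T : ∀ i → z + 1 ≤ i → i < z + 1 + t → bit T i ≡ true
        ones-T zero z+1≤0 _ = ⊥-elim (<-irrefl refl (<-≤-trans z<s (subst (_≤ 0) (+-comm z 1) z+1≤0)))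
        ones-T (suc i) z+1≤i i<z+1+t = trans (bit-T-shifted i (≤-trans i<b (b≤k*b 1≤k)))
                                         (trans (bit-sorted z≤L i) (trans (cong (step z) (m<n⇒m%n≡m i<b)) (step-≥ z z≤i)))
          where
          z≤i : z ≤ i
          z≤i = ≤-pred (subst (_≤ suc i) (+-comm z 1) z+1≤i)
          i<b : i < b
          i<b = subst (i <_) z+t≡b (≤-pred (subst (suc (suc i) ≤_) (cong (_+ t) (+-comm z 1)) i<z+1+t))
        z+1+t≡1+b : z + 1 + t ≡ suc b
        z+1+t≡1+b = trans (cong (_+ t) (+-comm z 1)) (cong suc z+t≡b)
        bit-T-1+b : Dec (suc b ≤ k * b) → bit T (suc b) ≡ false
        bit-T-1+b (yes b<kb) = trans (bit-T-shifted b b<kb) (trans (bit-+period C 0) bit-0)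
        bit-T-1+b (no b≮kb) = trans (bit-T-kept (suc b) (≰⇒> b≮kb) (<-≤-trans (subst (_< b + b) (+-comm b 1) (+-monoʳ-< b 2≤b)) b+b≤d))
                                (trans (bit-+period C 1) (trans (bit-sorted z≤L 1) (step-< z 1%b<z)))
          where
          k≡1 : k ≡ 1
          k≡1 = ≤-antisym (*-cancelʳ-≤ k 1 b (subst (k * b ≤_) (sym (+-identityʳ b)) (≤-pred (≰⇒> b≮kb)))) 1≤k
          1<z : 1 < z
          1<z = ≤∧≢⇒< 1≤z (λ 1≡z → ¬z≡1∧k≡1 (sym 1≡z) k≡1)
          1%b<z : 1 % b < z
          1%b<z = subst (_< z) (sym (m<n⇒m%n≡m 2≤b)) 1<z

      ∣T∣ : ∣ T ∣ ≡ s
      ∣T∣ = begin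
        ∣ T ∣                                                           ≡⟨ ∣build∣ g d ⟩
        count g d                                                       ≡⟨ cong (count g) (sym 1+kb+rest≡d) ⟩
        count g (suc (k * b + rest))                                    ≡⟨ count-+ (λ i → g (suc i)) (k * b) rest ⟩
        count (λ i → g (suc i)) (k * b) + count (λ i → g (suc (k * b + i))) rest
            ≡⟨ cong₂ _+_ (count-ext _ (bit C) (k * b) (λ i i<kb → if-yes (suc i ≤? k * b) i<kb))
                         (count-ext _ (λ i → bit C (k * b + suc i)) rest
                            (λ i _ → trans (if-no (suc (k * b + i) ≤? k * b) (<⇒≱ (s≤s (m≤m+n (k * b) i))))
                                           (cong (bit C) (sym (+-suc (k * b) i))))) ⟩
        count (bit C) (k * b) + count (λ i → bit C (k * b + suc i)) rest
            ≡⟨ cong (λ x → count (bit C) (k * b) + (bool→ℕ x + count (λ i → bit C (k * b + suc i)) rest))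
                    (sym (trans (cong (bit C) (+-identityʳ (k * b))) bit-C-kb)) ⟩
        count (bit C) (k * b) + count (λ i → bit C (k * b + i)) (suc rest) ≡⟨ sym (count-+ (bit C) (k * b) (suc rest)) ⟩
        count (bit C) (k * b + suc rest)                                ≡⟨ cong (count (bit C)) (trans (+-suc (k * b) rest) 1+kb+rest≡d) ⟩
        count (bit C) d                                                 ≡⟨ count-bit ⟩
        s                                                               ∎
        where
        open ≡-Reasoning
        g : ℕ → Bool
        g = shiftBlocks C k
        rest : ℕ
        rest = d' ∸ k * b
        1+kb+rest≡d : suc (k * b + rest) ≡ d
        1+kb+rest≡d = cong suc (m+[n∸m]≡n (<⇒≤ k*b<d'))

      -- As for the sorted family: a one of C lies within L + 1 = z + 1 steps of any position,
      -- and C's zero at k·b, the one removed, cannot be that one.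
      lyndonAt-shifted : ∀ r → suc r ≤ k * b → LyndonAt T (suc r)
      lyndonAt-shifted r 1+r≤kb with one-in-window r
      ... | i₀ , i₀≤L , C[r+i₀] with <-cmp (r + i₀) (k * b)
      ...   | tri< r+i₀<kb _ _ = LyndonAt-from-zeros T (suc r) (z + 1) zeros-T (i₀ , L<1+z i₀≤L ,
                trans (cong (bit T) (trans (+-suc i₀ r) (cong suc (+-comm i₀ r)))) (trans (bit-T-shifted (r + i₀) r+i₀<kb) C[r+i₀]))
      ...   | tri≈ _ r+i₀≡kb _ = ⊥-elim (true≢false (trans (sym C[r+i₀]) (trans (cong (bit C) r+i₀≡kb) bit-C-kb)))
      ...   | tri> _ _ kb<r+i₀ = LyndonAt-from-zeros T (suc r) (z + 1) zeros-T (i₀ ∸ 1 , ≤-<-trans (m∸n≤m i₀ 1) (L<1+z i₀≤L) ,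
                trans (cong (bit T) (i₀-1+1+r i₀ (<-≤-trans 1+r≤kb (<⇒≤ kb<r+i₀))))
                  (trans (bit-T-kept (r + i₀) kb<r+i₀ r+i₀<d) C[r+i₀]))
        where
        r+i₀<d : r + i₀ < d
        r+i₀<d = <-≤-trans (+-mono-<-≤ 1+r≤kb (≤-trans (subst (i₀ ≤_) (L≡z z≤L) i₀≤L) (<⇒≤ z<b))) (k*b+b≤d k<n)
        i₀-1+1+r : ∀ i → r < r + i → i ∸ 1 + suc r ≡ r + i
        i₀-1+1+r zero r<r+0 = ⊥-elim (<-irrefl (sym (+-identityʳ r)) r<r+0)
        i₀-1+1+r (suc i) _ = trans (+-comm i (suc r)) (sym (+-suc r i))

      lyndonAt-kept : ∀ r → k * b < suc r → suc r < d → LyndonAt T (suc r)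
      lyndonAt-kept r kb<1+r 1+r<d with one-in-window (suc r)
      ... | i₀ , i₀≤L , C[1+r+i₀] with suc r + i₀ <? d
      ...   | yes 1+r+i₀<d = LyndonAt-from-zeros T (suc r) (z + 1) zeros-T (i₀ , L<1+z i₀≤L ,
                trans (cong (bit T) (+-comm i₀ (suc r)))
                  (trans (bit-T-kept (suc r + i₀) (<-≤-trans kb<1+r (m≤m+n (suc r) i₀)) 1+r+i₀<d) C[1+r+i₀]))
      ...   | no 1+r+i₀≮d = LyndonAt-from-zeros T (suc r) (z + 1) zeros-T (d' ∸ suc r , d'∸[1+r]<z+1 ,
                trans (cong (bit T) (m∸n+n≡m (≤-pred 1+r<d))) (trans (bit-T-kept d' k*b<d' ≤-refl) bit-last))
        where
        d'∸[1+r]<z+1 : d' ∸ suc r < z + 1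
        d'∸[1+r]<z+1 = <-≤-trans (+-cancelˡ-< (suc r) (d' ∸ suc r) i₀
                                   (subst (_< suc r + i₀) (sym (m+[n∸m]≡n (≤-pred 1+r<d))) (≮⇒≥ 1+r+i₀≮d)))
                                 (<⇒≤ (L<1+z i₀≤L))

      lyndon : Lyndon T
      lyndon (suc r) _ 1+r<d with suc r ≤? k * b
      ... | yes 1+r≤kb = lyndonAt-shifted r 1+r≤kb
      ... | no 1+r≰kb = lyndonAt-kept r (≰⇒> 1+r≰kb) 1+r<d

    family-lyndon : ∀ {k} → 1 ≤ k → k < n → Lyndon (family s C k) × ∣ family s C k ∣ ≡ s
    family-lyndon {k} 1≤k k<n with familyView s C k
    ... | sorted L<z e rewrite e = Sorted.lyndon 1≤k k<n L<z , Sorted.∣T∣ 1≤k k<n L<z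
    ... | extreme _ _ _ e rewrite e = ZerosOnes.lyndon 1≤s s<d , ZerosOnes.∣T∣ 1≤s s<d
    ... | shifted z≤L ¬z≡1∧k≡1 e rewrite e = Shifted.lyndon 1≤k k<n z≤L ¬z≡1∧k≡1 , Shifted.∣T∣ 1≤k k<n z≤L ¬z≡1∧k≡1

module Decoding (d' : ℕ) where
  open Cyclic d'
  open Necklaces d'
  open Families d'

  module TwoSpecialNecklaces (C C′ : Vec Bool d) (s : ℕ) (∣C∣≡s : ∣ C ∣ ≡ s) (∣C′∣≡s : ∣ C′ ∣ ≡ s)
                             (1≤s : 1 ≤ s) (s<d : s < d) (nec : IsNecklace C) (nec′ : IsNecklace C′)
                             (special : ¬ Regular C) (special′ : ¬ Regular C′) where
    module X = SpecialNecklace C s ∣C∣≡s 1≤s s<d nec special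
    module Y = SpecialNecklace C′ s ∣C′∣≡s 1≤s s<d nec′ special′

    module BothSorted {k k′} (1≤k : 1 ≤ k) (k<n : k < X.n) (1≤k′ : 1 ≤ k′) (k′<n′ : k′ < Y.n)
                      (L<z : X.L < X.z) (L′<z′ : Y.L < Y.z)
                      (T≡T′ : build (sortBlocks C k) d ≡ build (sortBlocks C′ k′) d) where
      module S = X.Sorted 1≤k k<n L<z
      module S′ = Y.Sorted 1≤k′ k′<n′ L′<z′

      z≡z′∧t≡t′ : X.z ≡ Y.z × X.t ≡ Y.t
      z≡z′∧t≡t′ = LeadingRun-unique {S.T} X.1≤t Y.1≤t S.leadingRun (subst (λ T → LeadingRun T Y.z Y.t) (sym T≡T′) S′.leadingRun)

      b≡b′ : X.b ≡ Y.b
      b≡b′ = trans (sym X.z+t≡b) (trans (cong₂ _+_ (proj₁ z≡z′∧t≡t′) (proj₂ z≡z′∧t≡t′)) Y.z+t≡b)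

      n≡n′ : X.n ≡ Y.n
      n≡n′ = *-cancelʳ-≡ X.n Y.n X.b (trans X.n*b≡d (sym (subst (λ x → Y.n * x ≡ d) (sym b≡b′) Y.n*b≡d)))

      -- At position k·b + L the member built from C has the first one of a kept block,
      -- the one built from C′ a zero of a sorted block.
      k≮k′ : ¬ k < k′
      k≮k′ k<k′ = true≢false (trans (sym T[p]) (trans (cong (λ T → bit T p) T≡T′) T′[p]))
        where
        p : ℕ
        p = k * X.b + X.L
        T[p] : bit S.T p ≡ true
        T[p] = trans (S.bit-T-kept p (m≤m+n _ _) (<-≤-trans (+-monoʳ-< (k * X.b) X.L<b) (X.k*b+b≤d k<n)))
                 (trans (cong (bit C) (+-comm (k * X.b) X.L)) (trans (bit-+*period C X.L k) X.bit-firstOne))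
        p<k′b′ : p < k′ * Y.b
        p<k′b′ = <-≤-trans (+-monoʳ-< (k * X.b) X.L<b)
                   (subst (λ x → k * X.b + X.b ≤ k′ * x) b≡b′ (subst (_≤ k′ * X.b) (+-comm X.b (k * X.b)) (*-monoˡ-≤ X.b k<k′)))
        T′[p] : bit S′.T p ≡ false
        T′[p] = trans (S′.bit-T-sorted p p<k′b′)
                  (trans (cong (step Y.z) (trans (%-congʳ {o = p} (sym b≡b′)) (X.[q*b+x]%b≡x k X.L X.L<b)))
                    (step-< Y.z (subst (X.L <_) (proj₁ z≡z′∧t≡t′) L<z)))

      -- The last block is kept in both members.
      C≡C′ : k ≡ k′ → C ≡ C′
      C≡C′ refl = bit-ext C C′ λ i _ → begin
        bit C i                         ≡⟨ bit-%period C i ⟩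
        bit C (i % X.b)                 ≡⟨ sym (bit-+*period C (i % X.b) (X.n ∸ 1)) ⟩
        bit C (p i)                     ≡⟨ sym (S.bit-T-kept (p i) (kb≤p i) (p<d i)) ⟩
        bit S.T (p i)                   ≡⟨ cong (λ T → bit T (p i)) T≡T′ ⟩
        bit S′.T (p i)                  ≡⟨ S′.bit-T-kept (p i) (subst (λ x → k * x ≤ p i) b≡b′ (kb≤p i)) (p<d i) ⟩
        bit C′ (p i)                    ≡⟨ cong (bit C′) (cong₂ _+_ (%-congʳ {o = i} b≡b′) (cong₂ (λ x y → (x ∸ 1) * y) n≡n′ b≡b′)) ⟩
        bit C′ (i % Y.b + (Y.n ∸ 1) * Y.b) ≡⟨ bit-+*period C′ (i % Y.b) (Y.n ∸ 1) ⟩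
        bit C′ (i % Y.b)                ≡⟨ sym (bit-%period C′ i) ⟩
        bit C′ i                        ∎
        where
        open ≡-Reasoning
        p : ℕ → ℕ
        p i = i % X.b + (X.n ∸ 1) * X.b
        n∸1+1 : suc (X.n ∸ 1) ≡ X.n
        n∸1+1 = trans (+-comm 1 (X.n ∸ 1)) (m∸n+n≡m (≤-trans (s≤s z≤n) X.2≤n))
        kb≤p : ∀ i → k * X.b ≤ p i
        kb≤p i = ≤-trans (*-monoˡ-≤ X.b (≤-pred (subst (suc k ≤_) (sym n∸1+1) k<n))) (m≤n+m _ (i % X.b))
        p<d : ∀ i → p i < d
        p<d i = subst (p i <_) (trans (+-comm _ X.b) (trans (cong (_* X.b) n∸1+1) X.n*b≡d))
                  (subst (_< (X.n ∸ 1) * X.b + X.b) (+-comm ((X.n ∸ 1) * X.b) (i % X.b))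
                    (+-monoʳ-< ((X.n ∸ 1) * X.b) (m%n<n i X.b)))

    module BothShifted {k k′} (1≤k : 1 ≤ k) (k<n : k < X.n) (1≤k′ : 1 ≤ k′) (k′<n′ : k′ < Y.n)
                       (z≤L : X.z ≤ X.L) (z′≤L′ : Y.z ≤ Y.L)
                       (¬z≡1∧k≡1 : X.z ≡ 1 → k ≡ 1 → ⊥) (¬z′≡1∧k′≡1 : Y.z ≡ 1 → k′ ≡ 1 → ⊥)
                       (T≡T′ : build (shiftBlocks C k) d ≡ build (shiftBlocks C′ k′) d) where
      module S = X.Shifted 1≤k k<n z≤L ¬z≡1∧k≡1
      module S′ = Y.Shifted 1≤k′ k′<n′ z′≤L′ ¬z′≡1∧k′≡1

      z+1≡z′+1∧t≡t′ : X.z + 1 ≡ Y.z + 1 × X.t ≡ Y.t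
      z+1≡z′+1∧t≡t′ = LeadingRun-unique {S.T} X.1≤t Y.1≤t S.leadingRun
                        (subst (λ T → LeadingRun T (Y.z + 1) Y.t) (sym T≡T′) S′.leadingRun)

      z≡z′ : X.z ≡ Y.z
      z≡z′ = +-cancelʳ-≡ 1 X.z Y.z (proj₁ z+1≡z′+1∧t≡t′)

      b≡b′ : X.b ≡ Y.b
      b≡b′ = trans (sym X.z+t≡b) (trans (cong₂ _+_ z≡z′ (proj₂ z+1≡z′+1∧t≡t′)) Y.z+t≡b)

      C≡C′ : C ≡ C′
      C≡C′ = bit-ext C C′ λ i _ → trans (X.bit-sorted z≤L i) (trans (cong₂ step z≡z′ (%-congʳ {o = i} b≡b′)) (sym (Y.bit-sorted z′≤L′ i)))

      -- Position k·b + z holds a one of C's kept block k in the first member, but the shifted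
      -- last zero of block k of C′ in the second.
      k≮k′ : ¬ k < k′
      k≮k′ k<k′ = true≢false (trans (sym T[p+1]) (trans (cong (λ T → bit T (suc p)) T≡T′) T′[p+1]))
        where
        p : ℕ
        p = k * X.b + (X.z ∸ 1)
        p+1≡kb+z : suc p ≡ k * X.b + X.z
        p+1≡kb+z = trans (sym (+-suc (k * X.b) (X.z ∸ 1))) (cong (k * X.b +_) (trans (+-comm 1 (X.z ∸ 1)) (m∸n+n≡m X.1≤z)))
        T[p+1] : bit S.T (suc p) ≡ true
        T[p+1] = trans (S.bit-T-kept (suc p) (subst (k * X.b <_) (sym p+1≡kb+z) (m<m+n (k * X.b) X.1≤z))
                                      (subst (_< d) (sym p+1≡kb+z) (<-≤-trans (+-monoʳ-< (k * X.b) X.z<b) (X.k*b+b≤d k<n))))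
                   (trans (cong (bit C) p+1≡kb+z)
                     (trans (X.bit-sorted z≤L (k * X.b + X.z)) (trans (cong (step X.z) (X.[q*b+x]%b≡x k X.z X.z<b)) (step-≥ X.z ≤-refl))))
        p+1≤k′b′ : suc p ≤ k′ * Y.b
        p+1≤k′b′ = subst (suc p ≤_) (cong (k′ *_) b≡b′)
                     (≤-trans (subst (_≤ k * X.b + X.b) (sym p+1≡kb+z) (+-monoʳ-≤ (k * X.b) (<⇒≤ X.z<b)))
                       (subst (_≤ k′ * X.b) (+-comm X.b (k * X.b)) (*-monoˡ-≤ X.b k<k′)))
        T′[p+1] : bit S′.T (suc p) ≡ false
        T′[p+1] = trans (S′.bit-T-shifted p p+1≤k′b′)
                    (trans (Y.bit-sorted z′≤L′ p)
                      (trans (cong (step Y.z) (trans (%-congʳ {o = p} (sym b≡b′)) (X.[q*b+x]%b≡x k (X.z ∸ 1) (≤-<-trans (m∸n≤m X.z 1) X.z<b))))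
                        (step-< Y.z (subst (X.z ∸ 1 <_) z≡z′ (∸-monoʳ-< {o = 0} z<s X.1≤z)))))

    -- With z = 1 the block is 0 1^t, and t·d = s·(1 + t) pins down t.
    bothExtreme : X.z ≤ X.L → Y.z ≤ Y.L → X.z ≡ 1 → Y.z ≡ 1 → C ≡ C′
    bothExtreme z≤L z′≤L′ z≡1 z′≡1 =
      bit-ext C C′ λ i _ → trans (X.bit-sorted z≤L i) (trans (cong₂ step (trans z≡1 (sym z′≡1)) (%-congʳ {o = i} b≡b′)) (sym (Y.bit-sorted z′≤L′ i)))
      where
      t*[d∸s]≡s : ∀ t b → t * d ≡ s * b → b ≡ 1 + t → t * (d ∸ s) ≡ s
      t*[d∸s]≡s t b t*d≡s*b b≡1+t = begin
        t * (d ∸ s)         ≡⟨ *-distribˡ-∸ t d s ⟩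
        t * d ∸ t * s       ≡⟨ cong (_∸ t * s) (trans t*d≡s*b (cong (s *_) b≡1+t)) ⟩
        s * (1 + t) ∸ t * s ≡⟨ cong (_∸ t * s) (trans (*-suc s t) (cong (s +_) (*-comm s t))) ⟩
        s + t * s ∸ t * s   ≡⟨ m+n∸n≡m s (t * s) ⟩
        s                   ∎
        where open ≡-Reasoning
      t≡t′ : X.t ≡ Y.t
      t≡t′ = *-cancelʳ-≡ X.t Y.t (d ∸ s) {{>-nonZero (m<n⇒0<n∸m s<d)}}
               (trans (t*[d∸s]≡s X.t X.b X.t*d≡s*b (trans (sym X.z+t≡b) (cong (_+ X.t) z≡1)))
                      (sym (t*[d∸s]≡s Y.t Y.b Y.t*d≡s*b (trans (sym Y.z+t≡b) (cong (_+ Y.t) z′≡1)))))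
      b≡b′ : X.b ≡ Y.b
      b≡b′ = trans (sym X.z+t≡b) (trans (cong₂ _+_ (trans z≡1 (sym z′≡1)) t≡t′) Y.z+t≡b)

    -- Leading runs (z, t) and (z′ + 1, t′) give b = b′ + 1, so t·d = s·b = t′·d + s forces s = 0.
    sorted≢shifted : ∀ {k k′} (1≤k : 1 ≤ k) (k<n : k < X.n) (1≤k′ : 1 ≤ k′) (k′<n′ : k′ < Y.n)
                     (L<z : X.L < X.z) (z′≤L′ : Y.z ≤ Y.L) (¬z′≡1∧k′≡1 : Y.z ≡ 1 → k′ ≡ 1 → ⊥) →
                     build (sortBlocks C k) d ≢ build (shiftBlocks C′ k′) d
    sorted≢shifted {k} 1≤k k<n 1≤k′ k′<n′ L<z z′≤L′ ¬z′≡1∧k′≡1 T≡T′ = 1+n≢0 (trans (m∸n+n≡m′ 1≤s) s≡0)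
      where
      m∸n+n≡m′ : 1 ≤ s → suc (s ∸ 1) ≡ s
      m∸n+n≡m′ 1≤s = trans (+-comm 1 (s ∸ 1)) (m∸n+n≡m 1≤s)
      runs : X.z ≡ Y.z + 1 × X.t ≡ Y.t
      runs = LeadingRun-unique {build (sortBlocks C k) d} X.1≤t Y.1≤t (X.Sorted.leadingRun 1≤k k<n L<z)
               (subst (λ T → LeadingRun T (Y.z + 1) Y.t) (sym T≡T′) (Y.Shifted.leadingRun 1≤k′ k′<n′ z′≤L′ ¬z′≡1∧k′≡1))
      b≡b′+1 : X.b ≡ Y.b + 1
      b≡b′+1 = begin
        X.b               ≡⟨ sym X.z+t≡b ⟩
        X.z + X.t         ≡⟨ cong₂ _+_ (proj₁ runs) (proj₂ runs) ⟩
        Y.z + 1 + Y.t     ≡⟨ +-assoc Y.z 1 Y.t ⟩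
        Y.z + (1 + Y.t)   ≡⟨ cong (Y.z +_) (+-comm 1 Y.t) ⟩
        Y.z + (Y.t + 1)   ≡⟨ sym (+-assoc Y.z Y.t 1) ⟩
        Y.z + Y.t + 1     ≡⟨ cong (_+ 1) Y.z+t≡b ⟩
        Y.b + 1           ∎
        where open ≡-Reasoning
      s≡0 : s ≡ 0
      s≡0 = +-cancelˡ-≡ (X.t * d) s 0 (sym (begin
        X.t * d + 0       ≡⟨ +-identityʳ _ ⟩
        X.t * d           ≡⟨ X.t*d≡s*b ⟩
        s * X.b           ≡⟨ cong (s *_) b≡b′+1 ⟩
        s * (Y.b + 1)     ≡⟨ trans (*-distribˡ-+ s Y.b 1) (cong (s * Y.b +_) (*-identityʳ s)) ⟩
        s * Y.b + s       ≡⟨ cong (_+ s) (sym Y.t*d≡s*b) ⟩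
        Y.t * d + s       ≡⟨ cong (λ x → x * d + s) (sym (proj₂ runs)) ⟩
        X.t * d + s       ∎))
        where open ≡-Reasoning

    -- Leading run (z, t) = (d − s, s) would give b = d.
    sorted≢extreme : ∀ {k} (1≤k : 1 ≤ k) (k<n : k < X.n) (L<z : X.L < X.z) → build (sortBlocks C k) d ≢ build (zerosOnes s) d
    sorted≢extreme {k} 1≤k k<n L<z T≡T′ = <-irrefl b≡d X.b<d
      where
      runs : X.z ≡ d ∸ s × X.t ≡ s
      runs = LeadingRun-unique {build (sortBlocks C k) d} X.1≤t 1≤s (X.Sorted.leadingRun 1≤k k<n L<z)
               (subst (λ T → LeadingRun T (d ∸ s) s) (sym T≡T′) (ZerosOnes.leadingRun 1≤s s<d))
      b≡d : X.b ≡ d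
      b≡d = trans (sym X.z+t≡b) (trans (cong₂ _+_ (proj₁ runs) (proj₂ runs)) (m∸n+n≡m (<⇒≤ s<d)))

    -- Leading run (z + 1, t) = (d − s, s) would give b + 1 = d, but 2 ≤ b and 2 ≤ n.
    shifted≢extreme : ∀ {k} (1≤k : 1 ≤ k) (k<n : k < X.n) (z≤L : X.z ≤ X.L) (¬z≡1∧k≡1 : X.z ≡ 1 → k ≡ 1 → ⊥) →
                      build (shiftBlocks C k) d ≢ build (zerosOnes s) d
    shifted≢extreme {k} 1≤k k<n z≤L ¬z≡1∧k≡1 T≡T′ = <-irrefl b+1≡d (<-≤-trans (+-monoʳ-< X.b X.2≤b) X.b+b≤d)
      where
      runs : X.z + 1 ≡ d ∸ s × X.t ≡ s
      runs = LeadingRun-unique {build (shiftBlocks C k) d} X.1≤t 1≤s (X.Shifted.leadingRun 1≤k k<n z≤L ¬z≡1∧k≡1)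
               (subst (λ T → LeadingRun T (d ∸ s) s) (sym T≡T′) (ZerosOnes.leadingRun 1≤s s<d))
      b+1≡d : X.b + 1 ≡ d
      b+1≡d = begin
        X.b + 1           ≡⟨ cong (_+ 1) (sym X.z+t≡b) ⟩
        X.z + X.t + 1     ≡⟨ +-assoc X.z X.t 1 ⟩
        X.z + (X.t + 1)   ≡⟨ cong (X.z +_) (+-comm X.t 1) ⟩
        X.z + (1 + X.t)   ≡⟨ sym (+-assoc X.z 1 X.t) ⟩
        X.z + 1 + X.t     ≡⟨ cong₂ _+_ (proj₁ runs) (proj₂ runs) ⟩
        d ∸ s + s         ≡⟨ m∸n+n≡m (<⇒≤ s<d) ⟩
        d                 ∎
        where open ≡-Reasoning

  family-injective : ∀ (C C′ : Vec Bool d) s (∣C∣≡s : ∣ C ∣ ≡ s) (∣C′∣≡s : ∣ C′ ∣ ≡ s) (1≤s : 1 ≤ s) (s<d : s < d)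
    (nec : IsNecklace C) (nec′ : IsNecklace C′) (special : ¬ Regular C) (special′ : ¬ Regular C′) →
    ∀ {k k′} → 1 ≤ k → k < blocks C → 1 ≤ k′ → k′ < blocks C′ → family s C k ≡ family s C′ k′ → C ≡ C′ × k ≡ k′
  family-injective C C′ s ∣C∣≡s ∣C′∣≡s 1≤s s<d nec nec′ special special′ {k} {k′} 1≤k k<n 1≤k′ k′<n′ e =
    cases (familyView s C k) (familyView s C′ k′)
    where
    module CC′ = TwoSpecialNecklaces C C′ s ∣C∣≡s ∣C′∣≡s 1≤s s<d nec nec′ special special′
    module C′C = TwoSpecialNecklaces C′ C s ∣C′∣≡s ∣C∣≡s 1≤s s<d nec′ nec special′ special
    cases : FamilyView s C k (family s C k) → FamilyView s C′ k′ (family s C′ k′) → C ≡ C′ × k ≡ k′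
    cases (sorted L<z eT) (sorted L′<z′ eT′) with <-cmp k k′
    ... | tri< k<k′ _ _ = ⊥-elim (CC′.BothSorted.k≮k′ 1≤k k<n 1≤k′ k′<n′ L<z L′<z′ (trans (sym eT) (trans e eT′)) k<k′)
    ... | tri> _ _ k′<k = ⊥-elim (C′C.BothSorted.k≮k′ 1≤k′ k′<n′ 1≤k k<n L′<z′ L<z (trans (sym eT′) (trans (sym e) eT)) k′<k)
    ... | tri≈ _ k≡k′ _ = CC′.BothSorted.C≡C′ 1≤k k<n 1≤k′ k′<n′ L<z L′<z′ (trans (sym eT) (trans e eT′)) k≡k′ , k≡k′
    cases (sorted L<z eT) (extreme _ _ _ eT′) = ⊥-elim (CC′.sorted≢extreme 1≤k k<n L<z (trans (sym eT) (trans e eT′)))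
    cases (sorted L<z eT) (shifted z′≤L′ ¬z′≡1∧k′≡1 eT′) =
      ⊥-elim (CC′.sorted≢shifted 1≤k k<n 1≤k′ k′<n′ L<z z′≤L′ ¬z′≡1∧k′≡1 (trans (sym eT) (trans e eT′)))
    cases (extreme _ _ _ eT) (sorted L′<z′ eT′) = ⊥-elim (C′C.sorted≢extreme 1≤k′ k′<n′ L′<z′ (trans (sym eT′) (trans (sym e) eT)))
    cases (extreme z≤L z≡1 k≡1 _) (extreme z′≤L′ z′≡1 k′≡1 _) = CC′.bothExtreme z≤L z′≤L′ z≡1 z′≡1 , trans k≡1 (sym k′≡1)
    cases (extreme _ _ _ eT) (shifted z′≤L′ ¬z′≡1∧k′≡1 eT′) =
      ⊥-elim (C′C.shifted≢extreme 1≤k′ k′<n′ z′≤L′ ¬z′≡1∧k′≡1 (trans (sym eT′) (trans (sym e) eT)))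
    cases (shifted z≤L ¬z≡1∧k≡1 eT) (sorted L′<z′ eT′) =
      ⊥-elim (C′C.sorted≢shifted 1≤k′ k′<n′ 1≤k k<n L′<z′ z≤L ¬z≡1∧k≡1 (trans (sym eT′) (trans (sym e) eT)))
    cases (shifted z≤L ¬z≡1∧k≡1 eT) (extreme _ _ _ eT′) =
      ⊥-elim (CC′.shifted≢extreme 1≤k k<n z≤L ¬z≡1∧k≡1 (trans (sym eT) (trans e eT′)))
    cases (shifted z≤L ¬z≡1∧k≡1 eT) (shifted z′≤L′ ¬z′≡1∧k′≡1 eT′) with <-cmp k k′
    ... | tri< k<k′ _ _ = ⊥-elim (CC′.BothShifted.k≮k′ 1≤k k<n 1≤k′ k′<n′ z≤L z′≤L′ ¬z≡1∧k≡1 ¬z′≡1∧k′≡1 (trans (sym eT) (trans e eT′)) k<k′)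
    ... | tri> _ _ k′<k = ⊥-elim (C′C.BothShifted.k≮k′ 1≤k′ k′<n′ 1≤k k<n z′≤L′ z≤L ¬z′≡1∧k′≡1 ¬z≡1∧k≡1 (trans (sym eT′) (trans (sym e) eT)) k′<k)
    ... | tri≈ _ k≡k′ _ = CC′.BothShifted.C≡C′ 1≤k k<n 1≤k′ k′<n′ z≤L z′≤L′ ¬z≡1∧k≡1 ¬z′≡1∧k′≡1 (trans (sym eT) (trans e eT′)) , k≡k′

suc-<∸1 : ∀ {i n} → i < n ∸ 1 → suc i < n
suc-<∸1 {n = suc n} i<n = s≤s i<n

module Construction (d' s : ℕ) (1≤s : 1 ≤ s) (s<d : s < suc d') where
  open Cyclic d'
  open Necklaces d'
  open Families d'
  open Decoding d'

  Θ : (S : Subset d) → Special S → ∣ S ∣ ≡ s → List (Subset d)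
  Θ S _ _ = applyUpTo (λ i → family s (canon S) (suc i)) (blocks (canon S) ∸ 1)

  module Canonical (S : Subset d) (sp : Special S) (∣S∣≡s : ∣ S ∣ ≡ s) where
    C : Vec Bool d
    C = canon S

    ∣C∣≡s : ∣ C ∣ ≡ s
    ∣C∣≡s with canon-~ S
    ... | a , e = trans (cong ∣_∣ (sym e)) (trans (∣P^∣ a S) ∣S∣≡s)

    special : ¬ Regular C
    special reg = sp (Regular-~ (canon-~ S) reg)

    open SpecialNecklace C s ∣C∣≡s 1≤s s<d (canon-necklace S) special public using (n; 2≤n; family-lyndon)

    member : ∀ {i} → i < n ∸ 1 → Lyndon (family s C (suc i)) × ∣ family s C (suc i) ∣ ≡ s
    member i<n-1 = family-lyndon (s≤s z≤n) (suc-<∸1 i<n-1)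

    member-injective : ∀ {i j} → i < n ∸ 1 → j < n ∸ 1 → family s C (suc i) ~ family s C (suc j) → i ≡ j
    member-injective i<n-1 j<n-1 Tᵢ~Tⱼ = suc-injective (proj₂ (family-injective C C s ∣C∣≡s ∣C∣≡s 1≤s s<d
      (canon-necklace S) (canon-necklace S) special special (s≤s z≤n) (suc-<∸1 i<n-1) (s≤s z≤n) (suc-<∸1 j<n-1)
      (Lyndon-~⇒≡ _ _ (proj₁ (member i<n-1)) (proj₁ (member j<n-1)) Tᵢ~Tⱼ)))

    first∈Θ : family s C 1 ∈ Θ S sp ∣S∣≡s
    first∈Θ = ∈-applyUpTo⁺ (λ i → family s C (suc i)) (m<n⇒0<n∸m 2≤n)

  members-~ : ∀ S₁ S₂ (sp₁ : Special S₁) (sz₁ : ∣ S₁ ∣ ≡ s) (sp₂ : Special S₂) (sz₂ : ∣ S₂ ∣ ≡ s) →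
    ∀ {T₁ T₂} → T₁ ∈ Θ S₁ sp₁ sz₁ → T₂ ∈ Θ S₂ sp₂ sz₂ → T₁ ~ T₂ → canon S₁ ≡ canon S₂ × T₁ ≡ T₂
  members-~ S₁ S₂ sp₁ sz₁ sp₂ sz₂ T₁∈ T₂∈ T₁~T₂
    with ∈-applyUpTo⁻ (λ i → family s (canon S₁) (suc i)) T₁∈ | ∈-applyUpTo⁻ (λ i → family s (canon S₂) (suc i)) T₂∈
  ... | i , i<n₁-1 , refl | j , j<n₂-1 , refl =
    proj₁ (family-injective C₁.C C₂.C s C₁.∣C∣≡s C₂.∣C∣≡s 1≤s s<d (canon-necklace S₁) (canon-necklace S₂) C₁.special C₂.special
             (s≤s z≤n) (suc-<∸1 i<n₁-1) (s≤s z≤n) (suc-<∸1 j<n₂-1) T₁≡T₂) , T₁≡T₂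
    where
    module C₁ = Canonical S₁ sp₁ sz₁
    module C₂ = Canonical S₂ sp₂ sz₂
    T₁≡T₂ : family s C₁.C (suc i) ≡ family s C₂.C (suc j)
    T₁≡T₂ = Lyndon-~⇒≡ _ _ (proj₁ (C₁.member i<n₁-1)) (proj₁ (C₂.member j<n₂-1)) T₁~T₂

  Θ-regular : ∀ S (sp : Special S) (sz : ∣ S ∣ ≡ s) →
    All (λ T → Regular T × ∣ T ∣ ≡ s) (Θ S sp sz) × AllPairs (λ T T′ → ¬ (T ~ T′)) (Θ S sp sz)
  Θ-regular S sp sz =
      All.applyUpTo⁺₁ _ (n ∸ 1) (λ i<n-1 → Lyndon⇒Regular _ (proj₁ (member i<n-1)) , proj₂ (member i<n-1))
    , AllPairs.applyUpTo⁺₁ _ (n ∸ 1) λ i<j j<n-1 T~T′ → <-irrefl (member-injective (<-trans i<j j<n-1) j<n-1 T~T′) i<j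
    where open Canonical S sp sz

  Θ-cong : ∀ S₁ S₂ (sp₁ : Special S₁) (sz₁ : ∣ S₁ ∣ ≡ s) (sp₂ : Special S₂) (sz₂ : ∣ S₂ ∣ ≡ s) →
    S₁ ~ S₂ → SameClasses (Θ S₁ sp₁ sz₁) (Θ S₂ sp₂ sz₂)
  Θ-cong S₁ S₂ sp₁ sz₁ sp₂ sz₂ S₁~S₂ rewrite canon-cong S₁~S₂ =
    (λ {T} T∈ → T , T∈ , 0 , refl) , (λ {T} T∈ → T , T∈ , 0 , refl)

  Θ-injective : ∀ S₁ S₂ (sp₁ : Special S₁) (sz₁ : ∣ S₁ ∣ ≡ s) (sp₂ : Special S₂) (sz₂ : ∣ S₂ ∣ ≡ s) →
    SameClasses (Θ S₁ sp₁ sz₁) (Θ S₂ sp₂ sz₂) → S₁ ~ S₂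
  Θ-injective S₁ S₂ sp₁ sz₁ sp₂ sz₂ (covered , _) with covered (Canonical.first∈Θ S₁ sp₁ sz₁)
  ... | T′ , T′∈ , T~T′ = canon-injective (proj₁ (members-~ S₁ S₂ sp₁ sz₁ sp₂ sz₂ (Canonical.first∈Θ S₁ sp₁ sz₁) T′∈ T~T′))

  Θ-length : ∀ S (sp : Special S) (sz : ∣ S ∣ ≡ s) (b n′ : ℕ) → IsBlockSize S b → n′ * b ≡ d → length (Θ S sp sz) ≡ n′ ∸ 1
  Θ-length S sp sz b n′ bs n′*b≡d = trans (length-applyUpTo _ (n ∸ 1)) (cong (_∸ 1) (sym n′≡n))
    where
    open Canonical S sp sz
    b≡period : b ≡ period C
    b≡period = IsBlockSize-unique (IsBlockSize-~ (canon-~ S) bs) (proj₂ (period-spec C))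
    n′≡n : n′ ≡ n
    n′≡n = *-cancelʳ-≡ n′ n b {{>-nonZero (proj₁ bs)}} (trans n′*b≡d (sym (subst (λ x → n * x ≡ d) (sym b≡period) (blocks*period C))))

  Θ-disjoint : ∀ S₁ S₂ (sp₁ : Special S₁) (sz₁ : ∣ S₁ ∣ ≡ s) (sp₂ : Special S₂) (sz₂ : ∣ S₂ ∣ ≡ s) →
    ¬ (S₁ ~ S₂) → ∀ {T₁ T₂} → T₁ ∈ Θ S₁ sp₁ sz₁ → T₂ ∈ Θ S₂ sp₂ sz₂ → ¬ (T₁ ~ T₂)
  Θ-disjoint S₁ S₂ sp₁ sz₁ sp₂ sz₂ S₁≁S₂ T₁∈ T₂∈ T₁~T₂ =
    S₁≁S₂ (canon-injective (proj₁ (members-~ S₁ S₂ sp₁ sz₁ sp₂ sz₂ T₁∈ T₂∈ T₁~T₂)))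

lemma7p11 : (d s : ℕ) → 1 ≤ s → s < d →
    Σ ((S : Subset d) → Special S → ∣ S ∣ ≡ s → List (Subset d)) λ Θ →
      (∀ S (sp : Special S) (sz : ∣ S ∣ ≡ s) →
          All (λ T → Regular T × ∣ T ∣ ≡ s) (Θ S sp sz)
        × AllPairs (λ T T′ → ¬ (T ~ T′)) (Θ S sp sz))
    × (∀ S₁ S₂ (sp₁ : Special S₁) (sz₁ : ∣ S₁ ∣ ≡ s) (sp₂ : Special S₂) (sz₂ : ∣ S₂ ∣ ≡ s) →
          S₁ ~ S₂ → SameClasses (Θ S₁ sp₁ sz₁) (Θ S₂ sp₂ sz₂))
    × (∀ S₁ S₂ (sp₁ : Special S₁) (sz₁ : ∣ S₁ ∣ ≡ s) (sp₂ : Special S₂) (sz₂ : ∣ S₂ ∣ ≡ s) →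
          SameClasses (Θ S₁ sp₁ sz₁) (Θ S₂ sp₂ sz₂) → S₁ ~ S₂)
    × (∀ S (sp : Special S) (sz : ∣ S ∣ ≡ s) (b n : ℕ) →
          IsBlockSize S b → n * b ≡ d → length (Θ S sp sz) ≡ n ∸ 1)
    × (∀ S₁ S₂ (sp₁ : Special S₁) (sz₁ : ∣ S₁ ∣ ≡ s) (sp₂ : Special S₂) (sz₂ : ∣ S₂ ∣ ≡ s) →
          ¬ (S₁ ~ S₂) → ∀ {T₁ T₂} → T₁ ∈ Θ S₁ sp₁ sz₁ → T₂ ∈ Θ S₂ sp₂ sz₂ → ¬ (T₁ ~ T₂))
lemma7p11 zero s 1≤s ()
lemma7p11 (suc d') s 1≤s s<d = Θ , Θ-regular , Θ-cong , Θ-injective , Θ-length , Θ-disjoint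
  where open Construction d' s 1≤s s<d
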